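{- Let $\mu\in\Lambda$ and let $d\in\mathbb{Z}_{>0}$ satisfy $\mu_3\le p^d$. For $\theta,\theta'\in\mathrm{Der}_S$, the following are equivalent: (i) $\{\theta,\theta'\}$ is a basis for $D(\mathcal{A},\mu)$; (ii) $\{\Psi_d(\theta),\Psi_d(\theta')\}$ is a basis for $D(\mathcal{A},\mu+(p^d,p^d,0))$. Furthermore, $\Delta(\mu)=\Delta(\mu+(p^d,p^d,0))$.
   Context: Let $p$ be a prime, $\mathbb{F}=\mathbb{F}_p$, $S=\mathbb{F}[x,y]$, $\mathrm{Der}_S=S\partial_x\oplus S\partial_y$, where a derivation $\theta=f\partial_x+g\partial_y$ acts by $\theta(x)=f$, $\theta(y)=g$. Let $\mathcal{A}=\{H_1,H_2,H_3\}$ with $H_1=\ker x$, $H_2=\ker y$, $H_3=\ker(x+y)$, $\alpha_1=x,\alpha_2=y,\alpha_3=x+y$. For $\mu=(\mu_1,\mu_2,\mu_3)\in\Lambda\coloneqq\mathbb{Z}_{\ge0}^3$, $D(\mathcal{A},\mu)=\{\theta\in\mathrm{Der}_S:\theta(\alpha_i)\in\alpha_i^{\mu_i}S,\ i=1,2,3\}$; it is a free $S$-module of rank 2 with a homogeneous basis whose degrees (the exponents) are unique up to order; $\Delta(\mu)$ is the absolute difference of the two exponents. For $d>0$, $\Psi_d:\mathrm{Der}_S\to\mathrm{Der}_S$ is defined by $\Psi_d(\theta)=\theta(x)x^{p^d}\partial_x-\theta(y)y^{p^d}\partial_y$. -}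

module Defs where

open import Data.Nat as ℕ using (ℕ; zero; suc; _≤_; _∸_; ∣_-_∣)
open import Data.Integer as ℤ using (ℤ; +_; -_)
open import Data.Integer.Divisibility using () renaming (_∣_ to _∣ℤ_)
open import Data.Fin using (Fin; zero; suc)
open import Data.Product using (Σ; ∃; _×_; _,_)
open import Relation.Binary.PropositionalEquality using (_≡_; _≢_)

-- Elements of F_p[x,y] are represented by integer coefficient arrays
-- c : ℕ → ℕ → ℤ  (c i j = coefficient of x^i y^j), read modulo p,
-- and required to have finite support modulo p (predicate IsPoly).
Ser : Set
Ser = ℕ → ℕ → ℤ

infix 4 _≡[_]_ _≈[_]_ _≈ᵈ[_]_
infixl 6 _+ₛ_ _+ᵈ_
infixl 7 _*ₛ_ _·ᵈ_
infixr 8 _^ₛ_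

_≡[_]_ : ℤ → ℕ → ℤ → Set
a ≡[ p ] b = (+ p) ∣ℤ (a ℤ.- b)

_≈[_]_ : Ser → ℕ → Ser → Set
f ≈[ p ] g = ∀ i j → f i j ≡[ p ] g i j

IsPoly : ℕ → Ser → Set
IsPoly p f = Σ ℕ λ N → ∀ i j → N ≤ i ℕ.+ j → f i j ≡[ p ] + 0

zeroₛ oneₛ xₛ yₛ : Ser
zeroₛ _ _ = + 0
oneₛ zero zero = + 1
oneₛ _ _ = + 0
xₛ (suc zero) zero = + 1
xₛ _ _ = + 0
yₛ zero (suc zero) = + 1
yₛ _ _ = + 0

_+ₛ_ : Ser → Ser → Ser
(f +ₛ g) i j = f i j ℤ.+ g i j

-ₛ_ : Ser → Ser
(-ₛ f) i j = - f i j

sumUpTo : ℕ → (ℕ → ℤ) → ℤ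
sumUpTo zero h = h zero
sumUpTo (suc n) h = sumUpTo n h ℤ.+ h (suc n)

_*ₛ_ : Ser → Ser → Ser
(f *ₛ g) i j = sumUpTo i λ a → sumUpTo j λ b → f a b ℤ.* g (i ∸ a) (j ∸ b)

_^ₛ_ : Ser → ℕ → Ser
f ^ₛ zero = oneₛ
f ^ₛ suc n = f *ₛ (f ^ₛ n)

-- A derivation θ = f ∂x + g ∂y is the pair (f , g) = (θ(x) , θ(y)).
Der : Set
Der = Ser × Ser

IsDer : ℕ → Der → Set
IsDer p (f , g) = IsPoly p f × IsPoly p g

_+ᵈ_ : Der → Der → Der
(f , g) +ᵈ (f' , g') = (f +ₛ f') , (g +ₛ g')

_·ᵈ_ : Ser → Der → Der
a ·ᵈ (f , g) = (a *ₛ f) , (a *ₛ g)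

_≈ᵈ[_]_ : Der → ℕ → Der → Set
(f , g) ≈ᵈ[ p ] (f' , g') = (f ≈[ p ] f') × (g ≈[ p ] g')

zeroᵈ : Der
zeroᵈ = zeroₛ , zeroₛ

α : Fin 3 → Ser
α zero = xₛ
α (suc zero) = yₛ
α (suc (suc zero)) = xₛ +ₛ yₛ

-- θ(α_i), using linearity of θ
apply : Der → Fin 3 → Ser
apply (f , g) zero = f
apply (f , g) (suc zero) = g
apply (f , g) (suc (suc zero)) = f +ₛ g

Mult : Set
Mult = Fin 3 → ℕ

InD : ℕ → Mult → Der → Set
InD p μ θ = IsDer p θ ×
  (∀ i → Σ Ser λ h → IsPoly p h × (apply θ i ≈[ p ] ((α i ^ₛ μ i) *ₛ h)))

IsBasis : ℕ → Mult → Der → Der → Set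
IsBasis p μ θ θ' =
  InD p μ θ × InD p μ θ' ×
  (∀ η → InD p μ η → Σ Ser λ a → Σ Ser λ b →
     IsPoly p a × IsPoly p b × (η ≈ᵈ[ p ] ((a ·ᵈ θ) +ᵈ (b ·ᵈ θ')))) ×
  (∀ a b → IsPoly p a → IsPoly p b →
     ((a ·ᵈ θ) +ᵈ (b ·ᵈ θ')) ≈ᵈ[ p ] zeroᵈ → (a ≈[ p ] zeroₛ) × (b ≈[ p ] zeroₛ))

IsHomog : ℕ → ℕ → Der → Set
IsHomog p k (f , g) = ∀ i j → i ℕ.+ j ≢ k → (f i j ≡[ p ] + 0) × (g i j ≡[ p ] + 0)

HasExponents : ℕ → Mult → ℕ → ℕ → Set
HasExponents p μ k k' = Σ Der λ θ → Σ Der λ θ' →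
  IsBasis p μ θ θ' × IsHomog p k θ × IsHomog p k' θ'

HasΔ : ℕ → Mult → ℕ → Set
HasΔ p μ n = Σ ℕ λ k → Σ ℕ λ k' → HasExponents p μ k k' × n ≡ ∣ k - k' ∣

shift : ℕ → ℕ → Mult → Mult
shift p d μ zero = μ zero ℕ.+ p ℕ.^ d
shift p d μ (suc zero) = μ (suc zero) ℕ.+ p ℕ.^ d
shift p d μ (suc (suc zero)) = μ (suc (suc zero))

Ψ : ℕ → ℕ → Der → Der
Ψ p d (f , g) = (f *ₛ (xₛ ^ₛ (p ℕ.^ d))) , (-ₛ (g *ₛ (yₛ ^ₛ (p ℕ.^ d))))

module Submission where

-- Write q = p ^ d.  In characteristic p, (x + y) ^ q = x ^ q + y ^ q, so for θ = f ∂x + g ∂y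
--   Ψθ(x + y) = f x^q − g y^q = f (x + y)^q − (f + g) y^q.
-- When μ₃ ≤ q this is divisible by (x + y)^μ₃ exactly when f + g is, because x + y and y are
-- coprime; the conditions at x and y just gain the factors x^q and y^q.  Hence Ψ maps D(A, μ)
-- injectively and S-linearly into D(A, μ + (q, q, 0)), and onto it: every η there has
-- x^q ∣ η(x) and y^q ∣ η(y), so dividing out gives a preimage.  A linear isomorphism matches
-- bases, and it raises the degree of homogeneous elements by exactly q (a nonzero homogeneous
-- element of the target has degree ≥ q), so both exponents move by q and Δ is unchanged.

open import Defs
open import Level using (0ℓ)
open import Algebra.Bundles using (CommutativeRing)
open import Algebra.Definitions using (Congruent₁; Congruent₂)
open import Data.Fin as Fin using (Fin; zero; suc; toℕ; fromℕ; inject₁)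
import Data.Fin.Properties as Fin
open import Data.Integer as ℤ using (ℤ; +_)
import Data.Integer.Properties as ℤ
import Data.Integer.Divisibility.Signed as ℤ∣
open import Data.Integer.Tactic.RingSolver using (solve-∀)
open import Data.Nat as ℕ using (ℕ; zero; suc; _∸_; _≤_; _<_; z≤n; s≤s)
import Data.Nat.Properties as ℕ
import Algebra.Properties.CommutativeSemigroup ℕ.+-commutativeSemigroup as ℕ+
import Data.Nat.Tactic.RingSolver as ℕ-Solver
open import Data.Nat.Combinatorics using (_C_; nCn≡1; nC1≡n; nCk+nC[k+1]≡[n+1]C[k+1])
open import Data.Nat.Divisibility as ℕ∣ using (_∣_; ∣1⇒≡1; ∣⇒≤; ∣-refl)
open import Data.Nat.Primality using (Prime; euclidsLemma; prime⇒nonZero; ¬prime[1])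
open import Data.Product using (Σ; _×_; _,_; proj₁; proj₂)
open import Data.Sum as Sum using (_⊎_; inj₁; inj₂)
open import Data.Vec.Functional using (init)
open import Function.Base using (_∘_)
open import Function.Bundles using (_⇔_; mk⇔)
open import Relation.Binary.Core using (Rel; _⇒_)
open import Relation.Binary.Structures using (IsEquivalence)
open import Relation.Binary.PropositionalEquality
  using (_≡_; _≢_; refl; sym; trans; cong; cong₂; subst; module ≡-Reasoning)
open import Relation.Nullary using (¬_; yes; no; contradiction)

[k+1]*[n+1]C[k+1]≡[n+1]*nCk : ∀ n k → suc k ℕ.* (suc n C suc k) ≡ suc n ℕ.* (n C k)
[k+1]*[n+1]C[k+1]≡[n+1]*nCk zero    zero    = refl
[k+1]*[n+1]C[k+1]≡[n+1]*nCk zero    (suc k) = ℕ.*-zeroʳ (2 ℕ.+ k)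
[k+1]*[n+1]C[k+1]≡[n+1]*nCk (suc n) zero    =
  trans (ℕ.*-identityˡ _) (trans (nC1≡n (2 ℕ.+ n)) (sym (ℕ.*-identityʳ (2 ℕ.+ n))))
[k+1]*[n+1]C[k+1]≡[n+1]*nCk (suc n) (suc k) = begin
  (2 ℕ.+ k) ℕ.* (suc (suc n) C (2 ℕ.+ k))
    ≡⟨ cong ((2 ℕ.+ k) ℕ.*_) (nCk+nC[k+1]≡[n+1]C[k+1] (suc n) (suc k)) ⟨
  (2 ℕ.+ k) ℕ.* (suc n C suc k ℕ.+ suc n C (2 ℕ.+ k))
    ≡⟨ split k (suc n C suc k) (suc n C (2 ℕ.+ k)) ⟩
  suc n C suc k ℕ.+ (suc k ℕ.* (suc n C suc k) ℕ.+ (2 ℕ.+ k) ℕ.* (suc n C (2 ℕ.+ k)))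
    ≡⟨ cong₂ (λ a b → suc n C suc k ℕ.+ (a ℕ.+ b))
             ([k+1]*[n+1]C[k+1]≡[n+1]*nCk n k) ([k+1]*[n+1]C[k+1]≡[n+1]*nCk n (suc k)) ⟩
  suc n C suc k ℕ.+ (suc n ℕ.* (n C k) ℕ.+ suc n ℕ.* (n C suc k))
    ≡⟨ cong (suc n C suc k ℕ.+_) (ℕ.*-distribˡ-+ (suc n) (n C k) (n C suc k)) ⟨
  suc n C suc k ℕ.+ suc n ℕ.* (n C k ℕ.+ n C suc k)
    ≡⟨ cong (λ c → suc n C suc k ℕ.+ suc n ℕ.* c) (nCk+nC[k+1]≡[n+1]C[k+1] n k) ⟩
  suc n C suc k ℕ.+ suc n ℕ.* (suc n C suc k) ∎
  where
  open ≡-Reasoning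
  split : ∀ k a b → (2 ℕ.+ k) ℕ.* (a ℕ.+ b) ≡ a ℕ.+ ((1 ℕ.+ k) ℕ.* a ℕ.+ (2 ℕ.+ k) ℕ.* b)
  split = ℕ-Solver.solve-∀

p∣pCk : ∀ {p k} → Prime p → 0 < k → k < p → p ∣ p C k
p∣pCk {suc n} {suc k} p-prime _ k<p with euclidsLemma (suc k) (suc n C suc k) p-prime p∣[k+1]*pCk
  where p∣[k+1]*pCk : suc n ∣ suc k ℕ.* (suc n C suc k)
        p∣[k+1]*pCk = ℕ∣.divides (n C k) (trans ([k+1]*[n+1]C[k+1]≡[n+1]*nCk n k) (ℕ.*-comm (suc n) (n C k)))
... | inj₁ p∣k+1 = contradiction (∣⇒≤ p∣k+1) (ℕ.<⇒≱ k<p)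
... | inj₂ p∣pCk = p∣pCk

module _ {c ℓ} (R : CommutativeRing c ℓ) where
  open CommutativeRing R renaming (refl to ≈-refl; sym to ≈-sym; trans to ≈-trans)
  open import Algebra.Properties.Semiring.Exp semiring using (_^_; ^-congˡ; ^-congʳ; ^-assocʳ)
  open import Algebra.Properties.Semiring.Mult semiring
    using (×-cong; ×-congʳ; ×-homo-1; ×-assoc-*; ×1-homo-*) renaming (_×_ to _·_)
  open import Algebra.Properties.Monoid.Sum +-monoid using (sum; sum-init-last; sum-cong-≋; sum-replicate-zero)
  open import Algebra.Properties.CommutativeSemiring.Binomial commutativeSemiring using (theorem; binomialTerm)
  open import Relation.Binary.Reasoning.Setoid setoid
  open import Algebra.Properties.Ring ring using (-‿+-comm; -‿involutive; x[y-z]≈xy-xz)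
  open import Algebra.Properties.CommutativeSemigroup +-commutativeSemigroup using (interchange)
  open import Algebra.Properties.CommutativeSemigroup *-commutativeSemigroup using (x∙yz≈y∙xz)

  quotientRing : ∀ {ℓ′} (_∼_ : Rel Carrier ℓ′) → IsEquivalence _∼_ → _≈_ ⇒ _∼_ →
    Congruent₂ _∼_ _+_ → Congruent₂ _∼_ _*_ → Congruent₁ _∼_ (-_) → CommutativeRing c ℓ′
  quotientRing _∼_ ∼-equiv ≈⇒∼ +-cong∼ *-cong∼ -‿cong∼ = record
    { Carrier = Carrier ; _≈_ = _∼_ ; _+_ = _+_ ; _*_ = _*_ ; -_ = -_ ; 0# = 0# ; 1# = 1#
    ; isCommutativeRing = record
      { isRing = record
        { +-isAbelianGroup = record
          { isGroup = record
            { isMonoid = record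
              { isSemigroup = record
                { isMagma = record { isEquivalence = ∼-equiv ; ∙-cong = +-cong∼ }
                ; assoc = λ x y z → ≈⇒∼ (+-assoc x y z) }
              ; identity = (λ x → ≈⇒∼ (+-identityˡ x)) , (λ x → ≈⇒∼ (+-identityʳ x)) }
            ; inverse = (λ x → ≈⇒∼ (-‿inverseˡ x)) , (λ x → ≈⇒∼ (-‿inverseʳ x))
            ; ⁻¹-cong = -‿cong∼ }
          ; comm = λ x y → ≈⇒∼ (+-comm x y) }
        ; *-cong = *-cong∼
        ; *-assoc = λ x y z → ≈⇒∼ (*-assoc x y z)
        ; *-identity = (λ x → ≈⇒∼ (*-identityˡ x)) , (λ x → ≈⇒∼ (*-identityʳ x))
        ; distrib = (λ x y z → ≈⇒∼ (distribˡ x y z)) , (λ x y z → ≈⇒∼ (distribʳ x y z)) }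
      ; *-comm = λ x y → ≈⇒∼ (*-comm x y) } }

  [x+y]-[x+z]≈y-z : ∀ x y z → (x + y) - (x + z) ≈ y - z
  [x+y]-[x+z]≈y-z x y z = begin
    (x + y) + - (x + z)         ≈⟨ +-congˡ (-‿+-comm x z) ⟨
    (x + y) + (- x + - z)       ≈⟨ interchange x y (- x) (- z) ⟩
    (x - x) + (y - z)           ≈⟨ +-congʳ (-‿inverseʳ x) ⟩
    0# + (y - z)                ≈⟨ +-identityˡ (y - z) ⟩
    y - z                       ∎

  -- With A = (x + y)^μ₃ and B = (x + y)^(q − μ₃): the (x + y)-condition for θ gives that for Ψθ,
  -- and conversely.
  module _ (A B X Y f : Carrier) (AB≈X+Y : A * B ≈ X + Y) where

    private
      expand : ∀ c → A * (f * B - c) ≈ (f * X + f * Y) - A * c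
      expand c = begin
        A * (f * B - c)             ≈⟨ x[y-z]≈xy-xz A (f * B) c ⟩
        A * (f * B) - A * c         ≈⟨ +-congʳ (x∙yz≈y∙xz A f B) ⟩
        f * (A * B) - A * c         ≈⟨ +-congʳ (*-congˡ AB≈X+Y) ⟩
        f * (X + Y) - A * c         ≈⟨ +-congʳ (distribˡ f X Y) ⟩
        (f * X + f * Y) - A * c     ∎

    twist : ∀ g h → A * h ≈ f + g → A * (f * B - h * Y) ≈ f * X - g * Y
    twist g h Ah≈f+g = begin
      A * (f * B - h * Y)               ≈⟨ expand (h * Y) ⟩
      (f * X + f * Y) - A * (h * Y)     ≈⟨ +-congˡ (-‿cong (*-assoc A h Y)) ⟨
      (f * X + f * Y) - (A * h) * Y     ≈⟨ +-congˡ (-‿cong (≈-trans (*-congʳ Ah≈f+g) (distribʳ Y f g))) ⟩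
      (f * X + f * Y) - (f * Y + g * Y) ≈⟨ +-congʳ (+-comm (f * X) (f * Y)) ⟩
      (f * Y + f * X) - (f * Y + g * Y) ≈⟨ [x+y]-[x+z]≈y-z (f * Y) (f * X) (g * Y) ⟩
      f * X - g * Y                     ∎

    untwist : ∀ g k → A * k ≈ f * X - g * Y → A * (f * B - k) ≈ (f + g) * Y
    untwist g k Ak≈ = begin
      A * (f * B - k)                   ≈⟨ expand k ⟩
      (f * X + f * Y) - A * k           ≈⟨ +-congˡ (-‿cong Ak≈) ⟩
      (f * X + f * Y) - (f * X - g * Y) ≈⟨ [x+y]-[x+z]≈y-z (f * X) (f * Y) (- (g * Y)) ⟩
      f * Y - - (g * Y)                 ≈⟨ +-congˡ (-‿involutive (g * Y)) ⟩
      f * Y + g * Y                     ≈⟨ distribʳ Y f g ⟨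
      (f + g) * Y                       ∎

  p∣n⇒n·x≈0 : ∀ {p n} → p · 1# ≈ 0# → p ∣ n → ∀ x → n · x ≈ 0#
  p∣n⇒n·x≈0 {p} p·1≈0 (ℕ∣.divides c refl) x = begin
    (c ℕ.* p) · x                   ≈⟨ ×-congʳ (c ℕ.* p) (*-identityˡ x) ⟨
    (c ℕ.* p) · (1# * x)            ≈⟨ ×-assoc-* (c ℕ.* p) 1# x ⟨
    ((c ℕ.* p) · 1#) * x            ≈⟨ *-congʳ (×1-homo-* c p) ⟩
    ((c · 1#) * (p · 1#)) * x       ≈⟨ *-congʳ (*-congˡ p·1≈0) ⟩
    ((c · 1#) * 0#) * x             ≈⟨ *-congʳ (zeroʳ (c · 1#)) ⟩
    0# * x                          ≈⟨ zeroˡ x ⟩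
    0#                              ∎

  frobenius : ∀ {p} → Prime p → p · 1# ≈ 0# → ∀ x y → (x + y) ^ p ≈ x ^ p + y ^ p
  frobenius {zero}  p-prime = contradiction refl (ℕ.≢-nonZero⁻¹ 0 {{prime⇒nonZero p-prime}})
  frobenius {suc m} p-prime p·1≈0 x y = begin
    (x + y) ^ p                                       ≈⟨ theorem p x y ⟩
    t Fin.zero + sum (t ∘ Fin.suc)                    ≈⟨ +-congˡ (sum-init-last (t ∘ Fin.suc)) ⟩
    t Fin.zero + (sum (init (t ∘ Fin.suc)) + t (Fin.suc (fromℕ m)))
      ≈⟨ +-cong first (+-cong middle last) ⟩
    y ^ p + (0# + x ^ p)                              ≈⟨ +-congˡ (+-identityˡ (x ^ p)) ⟩
    y ^ p + x ^ p                                     ≈⟨ +-comm (y ^ p) (x ^ p) ⟩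
    x ^ p + y ^ p                                     ∎
    where
    p : ℕ
    p = suc m
    t : Fin (suc p) → Carrier
    t = binomialTerm x y p
    first : t Fin.zero ≈ y ^ p
    first = ≈-trans (×-homo-1 (1# * y ^ p)) (*-identityˡ (y ^ p))
    middle : sum (init (t ∘ Fin.suc)) ≈ 0#
    middle = ≈-trans (sum-cong-≋ vanishing) (sum-replicate-zero m)
      where
      vanishing : ∀ i → t (Fin.suc (inject₁ i)) ≈ 0#
      vanishing i = p∣n⇒n·x≈0 p·1≈0 (p∣pCk p-prime (s≤s z≤n) (s≤s i<m)) _
        where i<m : toℕ (inject₁ i) < m
              i<m = subst (_< m) (sym (Fin.toℕ-inject₁ i)) (Fin.toℕ<n i)
    last : t (Fin.suc (fromℕ m)) ≈ x ^ p
    last = begin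
      T (suc (toℕ (fromℕ m)))  ≡⟨ cong (T ∘ suc) (Fin.toℕ-fromℕ m) ⟩
      T p                      ≈⟨ ×-cong (nCn≡1 p) (*-congˡ (^-congʳ y (ℕ.n∸n≡0 p))) ⟩
      1 · (x ^ p * 1#)         ≈⟨ ×-homo-1 (x ^ p * 1#) ⟩
      x ^ p * 1#               ≈⟨ *-identityʳ (x ^ p) ⟩
      x ^ p                    ∎
      where T : ℕ → Carrier
            T n = (p C n) · (x ^ n * y ^ (p ∸ n))

  frobenius-^ : ∀ {p} → Prime p → p · 1# ≈ 0# →
    ∀ d x y → (x + y) ^ (p ℕ.^ d) ≈ x ^ (p ℕ.^ d) + y ^ (p ℕ.^ d)
  frobenius-^ p-prime p·1≈0 zero x y = begin
    (x + y) ^ 1      ≈⟨ *-identityʳ (x + y) ⟩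
    x + y            ≈⟨ +-cong (*-identityʳ x) (*-identityʳ y) ⟨
    x ^ 1 + y ^ 1    ∎
  frobenius-^ {p} p-prime p·1≈0 (suc d) x y = begin
    (x + y) ^ (p ℕ.* q)                ≈⟨ ^-assocʳ (x + y) p q ⟨
    ((x + y) ^ p) ^ q                  ≈⟨ ^-congˡ q (frobenius p-prime p·1≈0 x y) ⟩
    (x ^ p + y ^ p) ^ q                ≈⟨ frobenius-^ p-prime p·1≈0 d (x ^ p) (y ^ p) ⟩
    (x ^ p) ^ q + (y ^ p) ^ q          ≈⟨ +-cong (^-assocʳ x p q) (^-assocʳ y p q) ⟩
    x ^ (p ℕ.* q) + y ^ (p ℕ.* q)      ∎
    where q : ℕ
          q = p ℕ.^ d

module IntegersModulo (p : ℕ) where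

  -- A record, unlike Defs' _≡[_]_ (which unfolds to p ∣ ∣a − b∣), lets Agda infer a and b;
  -- _≈ᴰ_, _∣ₚ_ and _∈D[_] below are records for the same reason.
  infix 4 _≡ₚ_
  record _≡ₚ_ (a b : ℤ) : Set where
    constructor mk≡ₚ
    field ≡ₚ⇒≡[p] : a ≡[ p ] b
  open _≡ₚ_ public

  private
    toSigned : ∀ {a b} → a ≡ₚ b → + p ℤ∣.∣ a ℤ.- b
    toSigned (mk≡ₚ e) = ℤ∣.∣ᵤ⇒∣ e

    fromSigned : ∀ {a b m} → m ≡ a ℤ.- b → + p ℤ∣.∣ m → a ≡ₚ b
    fromSigned refl e = mk≡ₚ (ℤ∣.∣⇒∣ᵤ e)

  ≡⇒≡ₚ : ∀ {a b} → a ≡ b → a ≡ₚ b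
  ≡⇒≡ₚ {a} refl = fromSigned (sym (ℤ.+-inverseʳ a)) (ℤ∣.divides (+ 0) refl)

  ≡ₚ-refl : ∀ {a} → a ≡ₚ a
  ≡ₚ-refl = ≡⇒≡ₚ refl

  ≡ₚ-sym : ∀ {a b} → a ≡ₚ b → b ≡ₚ a
  ≡ₚ-sym {a} {b} e = fromSigned (identity a b) (ℤ∣.∣m⇒∣-m (toSigned e))
    where identity : ∀ a b → ℤ.- (a ℤ.- b) ≡ b ℤ.- a
          identity = solve-∀

  ≡ₚ-trans : ∀ {a b c} → a ≡ₚ b → b ≡ₚ c → a ≡ₚ c
  ≡ₚ-trans {a} {b} {c} e f = fromSigned (identity a b c) (ℤ∣.∣m∣n⇒∣m+n (toSigned e) (toSigned f))
    where identity : ∀ a b c → (a ℤ.- b) ℤ.+ (b ℤ.- c) ≡ a ℤ.- c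
          identity = solve-∀

  +-cong-≡ₚ : Congruent₂ _≡ₚ_ ℤ._+_
  +-cong-≡ₚ {a} {b} {c} {d} e f = fromSigned (identity a b c d) (ℤ∣.∣m∣n⇒∣m+n (toSigned e) (toSigned f))
    where identity : ∀ a b c d → (a ℤ.- b) ℤ.+ (c ℤ.- d) ≡ (a ℤ.+ c) ℤ.- (b ℤ.+ d)
          identity = solve-∀

  *-cong-≡ₚ : Congruent₂ _≡ₚ_ ℤ._*_
  *-cong-≡ₚ {a} {b} {c} {d} e f =
    fromSigned (identity a b c d) (ℤ∣.∣m∣n⇒∣m+n (ℤ∣.∣m⇒∣m*n c (toSigned e)) (ℤ∣.∣n⇒∣m*n b (toSigned f)))
    where identity : ∀ a b c d → (a ℤ.- b) ℤ.* c ℤ.+ b ℤ.* (c ℤ.- d) ≡ a ℤ.* c ℤ.- b ℤ.* d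
          identity = solve-∀

  -‿cong-≡ₚ : Congruent₁ _≡ₚ_ (ℤ.-_)
  -‿cong-≡ₚ {a} {b} e = fromSigned (identity a b) (ℤ∣.∣m⇒∣-m (toSigned e))
    where identity : ∀ a b → ℤ.- (a ℤ.- b) ≡ (ℤ.- a) ℤ.- (ℤ.- b)
          identity = solve-∀

  ∣⇒≡ₚ0 : ∀ {n} → p ℕ∣.∣ n → + n ≡ₚ + 0
  ∣⇒≡ₚ0 {n} p∣n = mk≡ₚ (subst (p ℕ∣.∣_) (sym (ℕ.+-identityʳ n)) p∣n)

  1≡ₚ0⇒p≡1 : + 1 ≡ₚ + 0 → p ≡ 1
  1≡ₚ0⇒p≡1 (mk≡ₚ p∣1) = ∣1⇒≡1 p∣1

module _ where
  open ≡-Reasoning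

  sumUpTo-cong : ∀ n {h h′ : ℕ → ℤ} → (∀ a → a ≤ n → h a ≡ h′ a) → sumUpTo n h ≡ sumUpTo n h′
  sumUpTo-cong zero    e = e 0 z≤n
  sumUpTo-cong (suc n) e =
    cong₂ ℤ._+_ (sumUpTo-cong n λ a a≤n → e a (ℕ.m≤n⇒m≤1+n a≤n)) (e (suc n) ℕ.≤-refl)

  sumUpTo-cong′ : ∀ n {h h′ : ℕ → ℤ} → (∀ a → h a ≡ h′ a) → sumUpTo n h ≡ sumUpTo n h′
  sumUpTo-cong′ n e = sumUpTo-cong n λ a _ → e a

  sumUpTo-distrib-+ : ∀ n (h h′ : ℕ → ℤ) → sumUpTo n (λ a → h a ℤ.+ h′ a) ≡ sumUpTo n h ℤ.+ sumUpTo n h′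
  sumUpTo-distrib-+ zero    h h′ = refl
  sumUpTo-distrib-+ (suc n) h h′ = begin
    sumUpTo n (λ a → h a ℤ.+ h′ a) ℤ.+ (h (suc n) ℤ.+ h′ (suc n))
      ≡⟨ cong (ℤ._+ (h (suc n) ℤ.+ h′ (suc n))) (sumUpTo-distrib-+ n h h′) ⟩
    (sumUpTo n h ℤ.+ sumUpTo n h′) ℤ.+ (h (suc n) ℤ.+ h′ (suc n))
      ≡⟨ middleFour (sumUpTo n h) (sumUpTo n h′) (h (suc n)) (h′ (suc n)) ⟩
    (sumUpTo n h ℤ.+ h (suc n)) ℤ.+ (sumUpTo n h′ ℤ.+ h′ (suc n)) ∎
    where middleFour : ∀ a b c d → (a ℤ.+ b) ℤ.+ (c ℤ.+ d) ≡ (a ℤ.+ c) ℤ.+ (b ℤ.+ d)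
          middleFour = solve-∀

  *-distribˡ-sumUpTo : ∀ n c (h : ℕ → ℤ) → c ℤ.* sumUpTo n h ≡ sumUpTo n (λ a → c ℤ.* h a)
  *-distribˡ-sumUpTo zero    c h = refl
  *-distribˡ-sumUpTo (suc n) c h =
    trans (ℤ.*-distribˡ-+ c (sumUpTo n h) (h (suc n))) (cong (ℤ._+ c ℤ.* h (suc n)) (*-distribˡ-sumUpTo n c h))

  *-distribʳ-sumUpTo : ∀ n c (h : ℕ → ℤ) → sumUpTo n h ℤ.* c ≡ sumUpTo n (λ a → h a ℤ.* c)
  *-distribʳ-sumUpTo zero    c h = refl
  *-distribʳ-sumUpTo (suc n) c h =
    trans (ℤ.*-distribʳ-+ c (sumUpTo n h) (h (suc n))) (cong (ℤ._+ h (suc n) ℤ.* c) (*-distribʳ-sumUpTo n c h))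

  sumUpTo-zero : ∀ n (h : ℕ → ℤ) → (∀ a → a ≤ n → h a ≡ + 0) → sumUpTo n h ≡ + 0
  sumUpTo-zero n h e = trans (sumUpTo-cong n e) (sum-of-zeros n)
    where
    sum-of-zeros : ∀ n → sumUpTo n (λ _ → + 0) ≡ + 0
    sum-of-zeros zero    = refl
    sum-of-zeros (suc n) = cong (ℤ._+ + 0) (sum-of-zeros n)

  sumUpTo-comm : ∀ m n (F : ℕ → ℕ → ℤ) →
    sumUpTo m (λ a → sumUpTo n (F a)) ≡ sumUpTo n (λ b → sumUpTo m (λ a → F a b))
  sumUpTo-comm zero    n F = refl
  sumUpTo-comm (suc m) n F = trans (cong (ℤ._+ sumUpTo n (F (suc m))) (sumUpTo-comm m n F))
    (sym (sumUpTo-distrib-+ n (λ b → sumUpTo m (λ a → F a b)) (F (suc m))))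

  sumUpTo-single : ∀ n m (h : ℕ → ℤ) → m ≤ n → (∀ a → a ≤ n → a ≢ m → h a ≡ + 0) → sumUpTo n h ≡ h m
  sumUpTo-single zero .zero h z≤n _ = refl
  sumUpTo-single (suc n) m h m≤1+n others with m ℕ.≟ suc n
  ... | yes refl = trans (cong (ℤ._+ h (suc n)) (sumUpTo-zero n h λ a a≤n → others a (ℕ.m≤n⇒m≤1+n a≤n) (a≢1+n a≤n)))
                         (ℤ.+-identityˡ (h (suc n)))
    where a≢1+n : ∀ {a} → a ≤ n → a ≢ suc n
          a≢1+n a≤n refl = ℕ.<-irrefl refl (s≤s a≤n)
  ... | no m≢1+n = trans (cong₂ ℤ._+_ (sumUpTo-single n m h m≤n λ a a≤n → others a (ℕ.m≤n⇒m≤1+n a≤n))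
                                      (others (suc n) ℕ.≤-refl (m≢1+n ∘ sym)))
                         (ℤ.+-identityʳ (h m))
    where m≤n : m ≤ n
          m≤n = ℕ.≤-pred (ℕ.≤∧≢⇒< m≤1+n m≢1+n)

  sumUpTo-reverse : ∀ n (h : ℕ → ℤ) → sumUpTo n h ≡ sumUpTo n (λ a → h (n ∸ a))
  sumUpTo-reverse zero    h = refl
  sumUpTo-reverse (suc n) h = begin
    sumUpTo n h ℤ.+ h (suc n)                        ≡⟨ cong (ℤ._+ h (suc n)) (sumUpTo-reverse n h) ⟩
    sumUpTo n (λ a → h (n ∸ a)) ℤ.+ h (suc n)        ≡⟨ ℤ.+-comm _ (h (suc n)) ⟩
    h (suc n) ℤ.+ sumUpTo n (λ a → h (n ∸ a))        ≡⟨ sumUpTo-unsnoc n (λ a → h (suc n ∸ a)) ⟨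
    sumUpTo (suc n) (λ a → h (suc n ∸ a))            ∎
    where
    sumUpTo-unsnoc : ∀ n (g : ℕ → ℤ) → sumUpTo (suc n) g ≡ g 0 ℤ.+ sumUpTo n (g ∘ suc)
    sumUpTo-unsnoc zero    g = refl
    sumUpTo-unsnoc (suc n) g = trans (cong (ℤ._+ g (2 ℕ.+ n)) (sumUpTo-unsnoc n g)) (ℤ.+-assoc (g 0) _ _)

  sumUpTo-triangle : ∀ n (F : ℕ → ℕ → ℤ) →
    sumUpTo n (λ a → sumUpTo a (F a)) ≡ sumUpTo n (λ c → sumUpTo (n ∸ c) (λ b → F (c ℕ.+ b) c))
  sumUpTo-triangle zero    F = refl
  sumUpTo-triangle (suc n) F = begin
    sumUpTo n (λ a → sumUpTo a (F a)) ℤ.+ sumUpTo (suc n) (F (suc n))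
      ≡⟨ cong (ℤ._+ sumUpTo (suc n) (F (suc n))) (sumUpTo-triangle n F) ⟩
    T n ℤ.+ (sumUpTo n (F (suc n)) ℤ.+ F (suc n) (suc n))
      ≡⟨ ℤ.+-assoc (T n) (sumUpTo n (F (suc n))) (F (suc n) (suc n)) ⟨
    (T n ℤ.+ sumUpTo n (F (suc n))) ℤ.+ F (suc n) (suc n)
      ≡⟨ cong₂ ℤ._+_ (trans (sym (sumUpTo-distrib-+ n _ (F (suc n)))) (sumUpTo-cong n column)) diagonal ⟩
    sumUpTo n (λ c → sumUpTo (suc n ∸ c) (λ b → F (c ℕ.+ b) c))
      ℤ.+ sumUpTo (suc n ∸ suc n) (λ b → F (suc n ℕ.+ b) (suc n)) ∎
    where
    T : ℕ → ℤ
    T n = sumUpTo n (λ c → sumUpTo (n ∸ c) (λ b → F (c ℕ.+ b) c))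
    diagonal : F (suc n) (suc n) ≡ sumUpTo (n ∸ n) (λ b → F (suc n ℕ.+ b) (suc n))
    diagonal rewrite ℕ.n∸n≡0 n | ℕ.+-identityʳ n = refl
    column : ∀ c → c ≤ n →
      sumUpTo (n ∸ c) (λ b → F (c ℕ.+ b) c) ℤ.+ F (suc n) c ≡ sumUpTo (suc n ∸ c) (λ b → F (c ℕ.+ b) c)
    column c c≤n rewrite ℕ.+-∸-assoc 1 c≤n =
      cong (λ k → sumUpTo (n ∸ c) (λ b → F (c ℕ.+ b) c) ℤ.+ F k c)
           (sym (trans (ℕ.+-suc c (n ∸ c)) (cong suc (ℕ.m+[n∸m]≡n c≤n))))

-- The power-series ring ℤ⟦x,y⟧: coefficient arrays up to exact equality

infix 4 _≐_
_≐_ : Rel Ser 0ℓ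
f ≐ g = ∀ i j → f i j ≡ g i j

≐-refl : ∀ {f} → f ≐ f
≐-refl i j = refl

≐-isEquivalence : IsEquivalence _≐_
≐-isEquivalence = record
  { refl = ≐-refl ; sym = λ e i j → sym (e i j) ; trans = λ e e′ i j → trans (e i j) (e′ i j) }

*ₛ-cong : Congruent₂ _≐_ _*ₛ_
*ₛ-cong e e′ i j = sumUpTo-cong′ i λ a → sumUpTo-cong′ j λ b → cong₂ ℤ._*_ (e a b) (e′ (i ∸ a) (j ∸ b))

δ : ℕ → ℕ → ℤ
δ a m with a ℕ.≟ m
... | yes _ = + 1
... | no  _ = + 0

δ-refl : ∀ m → δ m m ≡ + 1
δ-refl m with m ℕ.≟ m
... | yes _   = refl
... | no  m≢m = contradiction refl m≢m

δ-≢ : ∀ {a m} → a ≢ m → δ a m ≡ + 0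
δ-≢ {a} {m} a≢m with a ℕ.≟ m
... | yes a≡m = contradiction a≡m a≢m
... | no  _   = refl

mono : ℕ → ℕ → Ser
mono m n a b = δ a m ℤ.* δ b n

mono-≢ : ∀ {m n a b} → a ≢ m ⊎ b ≢ n → mono m n a b ≡ + 0
mono-≢ {m} {n} {a} {b} (inj₁ a≢m) = trans (cong (ℤ._* δ b n) (δ-≢ a≢m)) (ℤ.*-zeroˡ (δ b n))
mono-≢ {m} {n} {a} {b} (inj₂ b≢n) = trans (cong (δ a m ℤ.*_) (δ-≢ b≢n)) (ℤ.*-zeroʳ (δ a m))

*ₛ-mono-shift : ∀ m n f i j → (mono m n *ₛ f) (m ℕ.+ i) (n ℕ.+ j) ≡ f i j
*ₛ-mono-shift m n f i j = begin
  sumUpTo (m ℕ.+ i) (λ a → sumUpTo (n ℕ.+ j) λ b → mono m n a b ℤ.* f (m ℕ.+ i ∸ a) (n ℕ.+ j ∸ b))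
    ≡⟨ sumUpTo-single (m ℕ.+ i) m _ (ℕ.m≤m+n m i) (λ a _ a≢m →
         sumUpTo-zero (n ℕ.+ j) _ λ b _ → killed a b (inj₁ a≢m)) ⟩
  sumUpTo (n ℕ.+ j) (λ b → mono m n m b ℤ.* f (m ℕ.+ i ∸ m) (n ℕ.+ j ∸ b))
    ≡⟨ sumUpTo-single (n ℕ.+ j) n _ (ℕ.m≤m+n n j) (λ b _ b≢n → killed m b (inj₂ b≢n)) ⟩
  mono m n m n ℤ.* f (m ℕ.+ i ∸ m) (n ℕ.+ j ∸ n)
    ≡⟨ cong₂ ℤ._*_ (cong₂ ℤ._*_ (δ-refl m) (δ-refl n)) (cong₂ f (ℕ.m+n∸m≡n m i) (ℕ.m+n∸m≡n n j)) ⟩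
  + 1 ℤ.* f i j
    ≡⟨ ℤ.*-identityˡ (f i j) ⟩
  f i j ∎
  where
  open ≡-Reasoning
  killed : ∀ a b → a ≢ m ⊎ b ≢ n → mono m n a b ℤ.* f (m ℕ.+ i ∸ a) (n ℕ.+ j ∸ b) ≡ + 0
  killed a b off = trans (cong (ℤ._* f (m ℕ.+ i ∸ a) (n ℕ.+ j ∸ b)) (mono-≢ {m} {n} {a} {b} off))
                         (ℤ.*-zeroˡ (f (m ℕ.+ i ∸ a) (n ℕ.+ j ∸ b)))

*ₛ-mono-below : ∀ m n f i j → i < m ⊎ j < n → (mono m n *ₛ f) i j ≡ + 0
*ₛ-mono-below m n f i j lower = sumUpTo-zero i _ λ a a≤i → sumUpTo-zero j _ λ b b≤j →
  trans (cong (ℤ._* f (i ∸ a) (j ∸ b)) (mono-≢ {m} {n} {a} {b} (Sum.map (≢-below a≤i) (≢-below b≤j) lower)))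
        (ℤ.*-zeroˡ (f (i ∸ a) (j ∸ b)))
  where ≢-below : ∀ {a i m} → a ≤ i → i < m → a ≢ m
        ≢-below a≤i i<m refl = ℕ.<-irrefl refl (ℕ.≤-<-trans a≤i i<m)

oneₛ≐mono : oneₛ ≐ mono 0 0
oneₛ≐mono zero    zero    = refl
oneₛ≐mono zero    (suc j) = refl
oneₛ≐mono (suc i) j       = sym (ℤ.*-zeroˡ (δ j 0))

xₛ≐mono : xₛ ≐ mono 1 0
xₛ≐mono zero          j       = sym (ℤ.*-zeroˡ (δ j 0))
xₛ≐mono (suc zero)    zero    = refl
xₛ≐mono (suc zero)    (suc j) = refl
xₛ≐mono (suc (suc i)) j       = sym (ℤ.*-zeroˡ (δ j 0))

yₛ≐mono : yₛ ≐ mono 0 1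
yₛ≐mono zero    zero          = refl
yₛ≐mono zero    (suc zero)    = refl
yₛ≐mono zero    (suc (suc j)) = refl
yₛ≐mono (suc i) zero          = refl
yₛ≐mono (suc i) (suc zero)    = refl
yₛ≐mono (suc i) (suc (suc j)) = refl

module _ where
  open ≡-Reasoning

  *ₛ-identityˡ : ∀ f → oneₛ *ₛ f ≐ f
  *ₛ-identityˡ f i j = trans (*ₛ-cong oneₛ≐mono (≐-refl {f}) i j) (*ₛ-mono-shift 0 0 f i j)

  *ₛ-comm : ∀ f g → f *ₛ g ≐ g *ₛ f
  *ₛ-comm f g i j = begin
    sumUpTo i (λ a → sumUpTo j λ b → f a b ℤ.* g (i ∸ a) (j ∸ b))
      ≡⟨ sumUpTo-reverse i _ ⟩
    sumUpTo i (λ a → sumUpTo j λ b → f (i ∸ a) b ℤ.* g (i ∸ (i ∸ a)) (j ∸ b))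
      ≡⟨ sumUpTo-cong′ i (λ a → sumUpTo-reverse j _) ⟩
    sumUpTo i (λ a → sumUpTo j λ b → f (i ∸ a) (j ∸ b) ℤ.* g (i ∸ (i ∸ a)) (j ∸ (j ∸ b)))
      ≡⟨ sumUpTo-cong i (λ a a≤i → sumUpTo-cong j λ b b≤j →
           trans (cong₂ (λ u v → f (i ∸ a) (j ∸ b) ℤ.* g u v) (ℕ.m∸[m∸n]≡n a≤i) (ℕ.m∸[m∸n]≡n b≤j))
                 (ℤ.*-comm (f (i ∸ a) (j ∸ b)) (g a b))) ⟩
    sumUpTo i (λ a → sumUpTo j λ b → g a b ℤ.* f (i ∸ a) (j ∸ b)) ∎

  *ₛ-distribˡ-+ₛ : ∀ f g h → f *ₛ (g +ₛ h) ≐ (f *ₛ g) +ₛ (f *ₛ h)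
  *ₛ-distribˡ-+ₛ f g h i j =
    trans (sumUpTo-cong′ i λ a → trans (sumUpTo-cong′ j λ b → ℤ.*-distribˡ-+ (f a b) _ _) (sumUpTo-distrib-+ j _ _))
          (sumUpTo-distrib-+ i _ _)

  *ₛ-distribʳ-+ₛ : ∀ f g h → (g +ₛ h) *ₛ f ≐ (g *ₛ f) +ₛ (h *ₛ f)
  *ₛ-distribʳ-+ₛ f g h i j = trans (*ₛ-comm (g +ₛ h) f i j)
    (trans (*ₛ-distribˡ-+ₛ f g h i j) (cong₂ ℤ._+_ (*ₛ-comm f g i j) (*ₛ-comm f h i j)))

  *ₛ-assoc : ∀ f g h → (f *ₛ g) *ₛ h ≐ f *ₛ (g *ₛ h)
  *ₛ-assoc f g h i j = begin
    sumUpTo i (λ a → sumUpTo j λ b →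
      sumUpTo a (λ c → sumUpTo b λ d → f c d ℤ.* g (a ∸ c) (b ∸ d)) ℤ.* h (i ∸ a) (j ∸ b))
      ≡⟨ sumUpTo-cong′ i (λ a → sumUpTo-cong′ j λ b →
           trans (*-distribʳ-sumUpTo a _ _) (sumUpTo-cong′ a λ c → *-distribʳ-sumUpTo b _ _)) ⟩
    sumUpTo i (λ a → sumUpTo j λ b → sumUpTo a λ c → sumUpTo b λ d → T a b c d)
      ≡⟨ sumUpTo-cong′ i (λ a → sumUpTo-comm j a _) ⟩
    sumUpTo i (λ a → sumUpTo a λ c → sumUpTo j λ b → sumUpTo b λ d → T a b c d)
      ≡⟨ sumUpTo-triangle i _ ⟩
    sumUpTo i (λ c → sumUpTo (i ∸ c) λ a → sumUpTo j λ b → sumUpTo b λ d → T (c ℕ.+ a) b c d)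
      ≡⟨ sumUpTo-cong′ i (λ c → sumUpTo-cong′ (i ∸ c) λ a → sumUpTo-triangle j _) ⟩
    sumUpTo i (λ c → sumUpTo (i ∸ c) λ a → sumUpTo j λ d → sumUpTo (j ∸ d) λ b → T (c ℕ.+ a) (d ℕ.+ b) c d)
      ≡⟨ sumUpTo-cong′ i (λ c → sumUpTo-comm (i ∸ c) j _) ⟩
    sumUpTo i (λ c → sumUpTo j λ d → sumUpTo (i ∸ c) λ a → sumUpTo (j ∸ d) λ b → T (c ℕ.+ a) (d ℕ.+ b) c d)
      ≡⟨ sumUpTo-cong′ i (λ c → sumUpTo-cong′ j λ d →
           trans (sumUpTo-cong′ (i ∸ c) λ a → trans (sumUpTo-cong′ (j ∸ d) λ b → reindex c d a b)
                                                     (sym (*-distribˡ-sumUpTo (j ∸ d) (f c d) _)))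
                 (sym (*-distribˡ-sumUpTo (i ∸ c) (f c d) _))) ⟩
    sumUpTo i (λ c → sumUpTo j λ d →
      f c d ℤ.* sumUpTo (i ∸ c) (λ a → sumUpTo (j ∸ d) λ b → g a b ℤ.* h (i ∸ c ∸ a) (j ∸ d ∸ b))) ∎
    where
    T : ℕ → ℕ → ℕ → ℕ → ℤ
    T a b c d = f c d ℤ.* g (a ∸ c) (b ∸ d) ℤ.* h (i ∸ a) (j ∸ b)
    reindex : ∀ c d a b → T (c ℕ.+ a) (d ℕ.+ b) c d ≡ f c d ℤ.* (g a b ℤ.* h (i ∸ c ∸ a) (j ∸ d ∸ b))
    reindex c d a b rewrite ℕ.m+n∸m≡n c a | ℕ.m+n∸m≡n d b | ℕ.∸-+-assoc i c a | ℕ.∸-+-assoc j d b =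
      ℤ.*-assoc (f c d) _ _

ℤ⟦x,y⟧ : CommutativeRing 0ℓ 0ℓ
ℤ⟦x,y⟧ = record
  { Carrier = Ser ; _≈_ = _≐_ ; _+_ = _+ₛ_ ; _*_ = _*ₛ_ ; -_ = -ₛ_ ; 0# = zeroₛ ; 1# = oneₛ
  ; isCommutativeRing = record
    { isRing = record
      { +-isAbelianGroup = record
        { isGroup = record
          { isMonoid = record
            { isSemigroup = record
              { isMagma = record
                { isEquivalence = ≐-isEquivalence ; ∙-cong = λ e e′ i j → cong₂ ℤ._+_ (e i j) (e′ i j) }
              ; assoc = λ f g h i j → ℤ.+-assoc (f i j) (g i j) (h i j) }
            ; identity = (λ f i j → ℤ.+-identityˡ (f i j)) , (λ f i j → ℤ.+-identityʳ (f i j)) }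
          ; inverse = (λ f i j → ℤ.+-inverseˡ (f i j)) , (λ f i j → ℤ.+-inverseʳ (f i j))
          ; ⁻¹-cong = λ e i j → cong ℤ.-_ (e i j) }
        ; comm = λ f g i j → ℤ.+-comm (f i j) (g i j) }
      ; *-cong = *ₛ-cong
      ; *-assoc = *ₛ-assoc
      ; *-identity = *ₛ-identityˡ , (λ f i j → trans (*ₛ-comm f oneₛ i j) (*ₛ-identityˡ f i j))
      ; distrib = *ₛ-distribˡ-+ₛ , *ₛ-distribʳ-+ₛ }
    ; *-comm = *ₛ-comm } }

data ShiftView (m : ℕ) : ℕ → Set where
  above : ∀ k → ShiftView m (m ℕ.+ k)
  below : ∀ {i} → i < m → ShiftView m i

shiftView : ∀ m i → ShiftView m i
shiftView m i with m ℕ.≤? i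
... | yes m≤i = subst (ShiftView m) (ℕ.m+[n∸m]≡n m≤i) (above (i ∸ m))
... | no  m≰i = below (ℕ.≰⇒> m≰i)

*ₛ-mono-unique : ∀ m n f g → (∀ i j → g (m ℕ.+ i) (n ℕ.+ j) ≡ f i j) →
  (∀ i j → i < m ⊎ j < n → g i j ≡ + 0) → mono m n *ₛ f ≐ g
*ₛ-mono-unique m n f g shifted vanishing i j = go (shiftView m i) (shiftView n j)
  where
  go : ∀ {i j} → ShiftView m i → ShiftView n j → (mono m n *ₛ f) i j ≡ g i j
  go (above k) (above l) = trans (*ₛ-mono-shift m n f k l) (sym (shifted k l))
  go {i} {j} (below i<m) _ = trans (*ₛ-mono-below m n f i j (inj₁ i<m)) (sym (vanishing i j (inj₁ i<m)))
  go {i} {j} _ (below j<n) = trans (*ₛ-mono-below m n f i j (inj₂ j<n)) (sym (vanishing i j (inj₂ j<n)))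

mono-*ₛ-mono : ∀ a b c d → mono a b *ₛ mono c d ≐ mono (a ℕ.+ c) (b ℕ.+ d)
mono-*ₛ-mono a b c d = *ₛ-mono-unique a b (mono c d) (mono (a ℕ.+ c) (b ℕ.+ d))
  (λ i j → cong₂ ℤ._*_ (δ-+ a i c) (δ-+ b j d))
  (λ i j below → mono-≢ {a ℕ.+ c} {b ℕ.+ d} {i} {j} (Sum.map (<⇒≢+ c) (<⇒≢+ d) below))
  where
  δ-+ : ∀ a i c → δ (a ℕ.+ i) (a ℕ.+ c) ≡ δ i c
  δ-+ a i c with i ℕ.≟ c
  ... | yes refl = δ-refl (a ℕ.+ i)
  ... | no  i≢c  = δ-≢ (i≢c ∘ ℕ.+-cancelˡ-≡ a i c)
  <⇒≢+ : ∀ {i a} c → i < a → i ≢ a ℕ.+ c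
  <⇒≢+ {a = a} c i<a refl = ℕ.<⇒≱ i<a (ℕ.m≤m+n a c)

xₛ^≐mono : ∀ m → xₛ ^ₛ m ≐ mono m 0
xₛ^≐mono zero    = oneₛ≐mono
xₛ^≐mono (suc m) = λ i j → trans (*ₛ-cong xₛ≐mono (xₛ^≐mono m) i j) (mono-*ₛ-mono 1 0 m 0 i j)

yₛ^≐mono : ∀ n → yₛ ^ₛ n ≐ mono 0 n
yₛ^≐mono zero    = oneₛ≐mono
yₛ^≐mono (suc n) = λ i j → trans (*ₛ-cong yₛ≐mono (yₛ^≐mono n) i j) (mono-*ₛ-mono 0 1 0 n i j)

-- Reduction modulo p

module Modulo (p : ℕ) where
  open IntegersModulo p public

  infix 4 _≈ₚ_
  _≈ₚ_ : Rel Ser 0ℓ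
  f ≈ₚ g = ∀ i j → f i j ≡ₚ g i j

  ≈ₚ⇒≈[p] : ∀ {f g} → f ≈ₚ g → f ≈[ p ] g
  ≈ₚ⇒≈[p] e i j = ≡ₚ⇒≡[p] (e i j)

  ≈[p]⇒≈ₚ : ∀ {f g} → f ≈[ p ] g → f ≈ₚ g
  ≈[p]⇒≈ₚ e i j = mk≡ₚ (e i j)

  ≐⇒≈ₚ : ∀ {f g} → f ≐ g → f ≈ₚ g
  ≐⇒≈ₚ e i j = ≡⇒≡ₚ (e i j)

  sumUpTo-cong-≡ₚ : ∀ n {h h′ : ℕ → ℤ} → (∀ a → a ≤ n → h a ≡ₚ h′ a) → sumUpTo n h ≡ₚ sumUpTo n h′
  sumUpTo-cong-≡ₚ zero    e = e 0 z≤n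
  sumUpTo-cong-≡ₚ (suc n) e =
    +-cong-≡ₚ (sumUpTo-cong-≡ₚ n λ a a≤n → e a (ℕ.m≤n⇒m≤1+n a≤n)) (e (suc n) ℕ.≤-refl)

  sumUpTo-≡ₚ0 : ∀ n {h : ℕ → ℤ} → (∀ a → a ≤ n → h a ≡ₚ + 0) → sumUpTo n h ≡ₚ + 0
  sumUpTo-≡ₚ0 n e = ≡ₚ-trans (sumUpTo-cong-≡ₚ n e) (≡⇒≡ₚ (sumUpTo-zero n _ λ _ _ → refl))

  ≈ₚ-isEquivalence : IsEquivalence _≈ₚ_
  ≈ₚ-isEquivalence = record
    { refl = λ i j → ≡⇒≡ₚ refl ; sym = λ e i j → ≡ₚ-sym (e i j) ; trans = λ e e′ i j → ≡ₚ-trans (e i j) (e′ i j) }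

  -- Arrays of finite support modulo p (Poly below) form the subring F_p[x,y] = S.
  𝔽ₚ⟦x,y⟧ : CommutativeRing 0ℓ 0ℓ
  𝔽ₚ⟦x,y⟧ = quotientRing ℤ⟦x,y⟧ _≈ₚ_ ≈ₚ-isEquivalence ≐⇒≈ₚ
    (λ e e′ i j → +-cong-≡ₚ (e i j) (e′ i j))
    (λ e e′ i j → sumUpTo-cong-≡ₚ i λ a _ → sumUpTo-cong-≡ₚ j λ b _ → *-cong-≡ₚ (e a b) (e′ (i ∸ a) (j ∸ b)))
    (λ e i j → -‿cong-≡ₚ (e i j))

  open CommutativeRing 𝔽ₚ⟦x,y⟧ public
    using ( setoid; +-cong; +-congˡ; +-congʳ; +-identityˡ; +-identityʳ; -‿cong
          ; *-cong; *-congˡ; *-congʳ; *-assoc; *-comm; *-identityˡ; zeroˡ; distribˡ; distribʳ; semiring)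
    renaming (refl to ≈ₚ-refl; sym to ≈ₚ-sym; trans to ≈ₚ-trans)
  open import Algebra.Properties.Semiring.Exp semiring using (_^_)
  open import Algebra.Properties.Semiring.Mult semiring using () renaming (_×_ to _·_)
  open import Algebra.Properties.Ring (CommutativeRing.ring 𝔽ₚ⟦x,y⟧)
    using (-‿distribˡ-*; -‿distribʳ-*; -‿involutive; -‿injective; -‿+-comm)
  open import Algebra.Properties.CommutativeSemigroup (CommutativeRing.*-commutativeSemigroup 𝔽ₚ⟦x,y⟧)
    using (x∙yz≈y∙xz)

  ^ₛ≈ₚ^ : ∀ f n → f ^ₛ n ≈ₚ f ^ n
  ^ₛ≈ₚ^ f zero    = ≈ₚ-refl
  ^ₛ≈ₚ^ f (suc n) = *-congˡ {f} (^ₛ≈ₚ^ f n)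

  ·-coefficient : ∀ n f i j → (n · f) i j ≡ + n ℤ.* f i j
  ·-coefficient zero    f i j = sym (ℤ.*-zeroˡ (f i j))
  ·-coefficient (suc n) f i j =
    trans (cong (ℤ._+_ (f i j)) (·-coefficient n f i j)) (sym (ℤ.suc-* (+ n) (f i j)))

  p·1≈ₚ0 : p · oneₛ ≈ₚ zeroₛ
  p·1≈ₚ0 i j = ≡ₚ-trans (≡⇒≡ₚ (·-coefficient p oneₛ i j))
    (≡ₚ-trans (*-cong-≡ₚ (∣⇒≡ₚ0 ∣-refl) (≡⇒≡ₚ refl)) (≡⇒≡ₚ (ℤ.*-zeroˡ (oneₛ i j))))

  frobeniusₛ : Prime p → ∀ d → (xₛ +ₛ yₛ) ^ₛ (p ℕ.^ d) ≈ₚ xₛ ^ₛ (p ℕ.^ d) +ₛ yₛ ^ₛ (p ℕ.^ d)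
  frobeniusₛ p-prime d = begin
    (xₛ +ₛ yₛ) ^ₛ q            ≈⟨ ^ₛ≈ₚ^ (xₛ +ₛ yₛ) q ⟩
    (xₛ +ₛ yₛ) ^ q             ≈⟨ frobenius-^ 𝔽ₚ⟦x,y⟧ p-prime p·1≈ₚ0 d xₛ yₛ ⟩
    xₛ ^ q +ₛ yₛ ^ q           ≈⟨ +-cong (^ₛ≈ₚ^ xₛ q) (^ₛ≈ₚ^ yₛ q) ⟨
    xₛ ^ₛ q +ₛ yₛ ^ₛ q         ∎
    where q : ℕ
          q = p ℕ.^ d
          open import Relation.Binary.Reasoning.Setoid setoid

  Poly : Ser → Set
  Poly f = Σ ℕ λ N → ∀ i j → N ≤ i ℕ.+ j → f i j ≡ₚ + 0

  IsPoly⇒Poly : ∀ {f} → IsPoly p f → Poly f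
  IsPoly⇒Poly (N , vanish) = N , λ i j bound → mk≡ₚ (vanish i j bound)

  Poly⇒IsPoly : ∀ {f} → Poly f → IsPoly p f
  Poly⇒IsPoly (N , vanish) = N , λ i j bound → ≡ₚ⇒≡[p] (vanish i j bound)

  poly-resp : ∀ {f g} → f ≈ₚ g → Poly f → Poly g
  poly-resp f≈g (N , vanish) = N , λ i j bound → ≡ₚ-trans (≡ₚ-sym (f≈g i j)) (vanish i j bound)

  poly-+ₛ : ∀ {f g} → Poly f → Poly g → Poly (f +ₛ g)
  poly-+ₛ (N , vanishf) (M , vanishg) = N ℕ.⊔ M , λ i j bound →
    +-cong-≡ₚ (vanishf i j (ℕ.≤-trans (ℕ.m≤m⊔n N M) bound)) (vanishg i j (ℕ.≤-trans (ℕ.m≤n⊔m N M) bound))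

  poly-neg : ∀ {f} → Poly f → Poly (-ₛ f)
  poly-neg (N , vanish) = N , λ i j bound → -‿cong-≡ₚ (vanish i j bound)

  poly-*ₛ : ∀ {f g} → Poly f → Poly g → Poly (f *ₛ g)
  poly-*ₛ {f} {g} (N , vanishf) (M , vanishg) = N ℕ.+ M , λ i j bound →
    sumUpTo-≡ₚ0 i λ a a≤i → sumUpTo-≡ₚ0 j λ b b≤j → term bound a≤i b≤j
    where
    term : ∀ {i j a b} → N ℕ.+ M ≤ i ℕ.+ j → a ≤ i → b ≤ j → f a b ℤ.* g (i ∸ a) (j ∸ b) ≡ₚ + 0
    term {i} {j} {a} {b} bound a≤i b≤j with N ℕ.≤? a ℕ.+ b | M ℕ.≤? (i ∸ a) ℕ.+ (j ∸ b)
    ... | yes N≤ | _ =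
      ≡ₚ-trans (*-cong-≡ₚ (vanishf a b N≤) (≡ₚ-refl {g (i ∸ a) (j ∸ b)})) (≡⇒≡ₚ (ℤ.*-zeroˡ (g (i ∸ a) (j ∸ b))))
    ... | no _ | yes M≤ =
      ≡ₚ-trans (*-cong-≡ₚ (≡ₚ-refl {f a b}) (vanishg (i ∸ a) (j ∸ b) M≤)) (≡⇒≡ₚ (ℤ.*-zeroʳ (f a b)))
    ... | no N≰ | no M≰ =
      contradiction bound (ℕ.<⇒≱ (subst (ℕ._< N ℕ.+ M) split (ℕ.+-mono-< (ℕ.≰⇒> N≰) (ℕ.≰⇒> M≰))))
      where
      split : (a ℕ.+ b) ℕ.+ ((i ∸ a) ℕ.+ (j ∸ b)) ≡ i ℕ.+ j
      split = trans (interchange a b (i ∸ a) (j ∸ b)) (cong₂ ℕ._+_ (ℕ.m+[n∸m]≡n a≤i) (ℕ.m+[n∸m]≡n b≤j))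
        where interchange : ∀ a b c d → (a ℕ.+ b) ℕ.+ (c ℕ.+ d) ≡ (a ℕ.+ c) ℕ.+ (b ℕ.+ d)
              interchange = ℕ-Solver.solve-∀

  poly-mono : ∀ m n → Poly (mono m n)
  poly-mono m n = suc (m ℕ.+ n) , λ i j bound → ≡⇒≡ₚ (mono-≢ {m} {n} {i} {j} (off-diagonal bound))
    where
    off-diagonal : ∀ {i j} → suc (m ℕ.+ n) ≤ i ℕ.+ j → i ≢ m ⊎ j ≢ n
    off-diagonal {i} {j} bound with i ℕ.≟ m | j ℕ.≟ n
    ... | yes refl | yes refl = contradiction bound (ℕ.<-irrefl refl)
    ... | no i≢m   | _        = inj₁ i≢m
    ... | yes _    | no j≢n   = inj₂ j≢n

  poly-xₛ^ : ∀ m → Poly (xₛ ^ₛ m)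
  poly-xₛ^ m = poly-resp (≐⇒≈ₚ (λ i j → sym (xₛ^≐mono m i j))) (poly-mono m 0)

  poly-yₛ^ : ∀ n → Poly (yₛ ^ₛ n)
  poly-yₛ^ n = poly-resp (≐⇒≈ₚ (λ i j → sym (yₛ^≐mono n i j))) (poly-mono 0 n)

  poly-^ₛ : ∀ {f} n → Poly f → Poly (f ^ₛ n)
  poly-^ₛ zero    _      = poly-xₛ^ 0
  poly-^ₛ (suc n) f-poly = poly-*ₛ f-poly (poly-^ₛ n f-poly)

  poly-shift : ∀ {f} m n → Poly f → Poly (λ i j → f (m ℕ.+ i) (n ℕ.+ j))
  poly-shift m n (N , vanish) = N , λ i j bound → vanish (m ℕ.+ i) (n ℕ.+ j) (ℕ.≤-trans bound (grow i j))
    where grow : ∀ i j → i ℕ.+ j ≤ (m ℕ.+ i) ℕ.+ (n ℕ.+ j)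
          grow i j = ℕ.+-mono-≤ (ℕ.m≤n+m i m) (ℕ.m≤n+m j n)

  infix 4 _∣ₚ_
  record _∣ₚ_ (a f : Ser) : Set where
    constructor divides
    field
      quotient      : Ser
      quotient-poly : Poly quotient
      equality      : f ≈ₚ a *ₛ quotient

  ∣ₚ-resp : ∀ {a f f′} → f ≈ₚ f′ → a ∣ₚ f → a ∣ₚ f′
  ∣ₚ-resp f≈f′ (divides h h-poly f≈ah) = divides h h-poly (≈ₚ-trans (≈ₚ-sym f≈f′) f≈ah)

  module _ {g : Ser} (m n : ℕ) (g≐mono : g ≐ mono m n) where

    monomial-shift : ∀ f i j → (g *ₛ f) (m ℕ.+ i) (n ℕ.+ j) ≡ f i j
    monomial-shift f i j = trans (*ₛ-cong g≐mono (≐-refl {f}) (m ℕ.+ i) (n ℕ.+ j)) (*ₛ-mono-shift m n f i j)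

    monomial-below : ∀ f i j → i < m ⊎ j < n → (g *ₛ f) i j ≡ + 0
    monomial-below f i j lower = trans (*ₛ-cong g≐mono (≐-refl {f}) i j) (*ₛ-mono-below m n f i j lower)

    monomial-cancel : ∀ {f f′} → g *ₛ f ≈ₚ g *ₛ f′ → f ≈ₚ f′
    monomial-cancel {f} {f′} e i j = ≡ₚ-trans (≡⇒≡ₚ (sym (monomial-shift f i j)))
      (≡ₚ-trans (e (m ℕ.+ i) (n ℕ.+ j)) (≡⇒≡ₚ (monomial-shift f′ i j)))

    monomial-shiftʳ : ∀ f i j → (f *ₛ g) (m ℕ.+ i) (n ℕ.+ j) ≡ f i j
    monomial-shiftʳ f i j = trans (*ₛ-comm f g (m ℕ.+ i) (n ℕ.+ j)) (monomial-shift f i j)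

    monomial-belowʳ : ∀ f i j → i < m ⊎ j < n → (f *ₛ g) i j ≡ + 0
    monomial-belowʳ f i j lower = trans (*ₛ-comm f g i j) (monomial-below f i j lower)

    monomial-cancelʳ : ∀ {f f′} → f *ₛ g ≈ₚ f′ *ₛ g → f ≈ₚ f′
    monomial-cancelʳ {f} {f′} e = monomial-cancel (≈ₚ-trans (*-comm g f) (≈ₚ-trans e (*-comm f′ g)))

    monomial∣-below : ∀ {f} → g ∣ₚ f → ∀ {i j} → i < m ⊎ j < n → f i j ≡ₚ + 0
    monomial∣-below (divides h _ f≈gh) {i} {j} lower = ≡ₚ-trans (f≈gh i j) (≡⇒≡ₚ (monomial-below h i j lower))

  ^ₛ-homo-*ₛ : ∀ f m n → f ^ₛ (m ℕ.+ n) ≈ₚ f ^ₛ m *ₛ f ^ₛ n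
  ^ₛ-homo-*ₛ f zero    n = ≈ₚ-sym (*-identityˡ (f ^ₛ n))
  ^ₛ-homo-*ₛ f (suc m) n = ≈ₚ-trans (*-congˡ {f} (^ₛ-homo-*ₛ f m n)) (≈ₚ-sym (*-assoc f (f ^ₛ m) (f ^ₛ n)))

  [gᵐh]gⁿ≈gᵐ⁺ⁿh : ∀ g m n h → (g ^ₛ m *ₛ h) *ₛ g ^ₛ n ≈ₚ g ^ₛ (m ℕ.+ n) *ₛ h
  [gᵐh]gⁿ≈gᵐ⁺ⁿh g m n h = begin
    (g ^ₛ m *ₛ h) *ₛ g ^ₛ n       ≈⟨ *-assoc (g ^ₛ m) h (g ^ₛ n) ⟩
    g ^ₛ m *ₛ (h *ₛ g ^ₛ n)       ≈⟨ *-congˡ {g ^ₛ m} (*-comm h (g ^ₛ n)) ⟩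
    g ^ₛ m *ₛ (g ^ₛ n *ₛ h)       ≈⟨ *-assoc (g ^ₛ m) (g ^ₛ n) h ⟨
    (g ^ₛ m *ₛ g ^ₛ n) *ₛ h       ≈⟨ *-congʳ {h} (^ₛ-homo-*ₛ g m n) ⟨
    g ^ₛ (m ℕ.+ n) *ₛ h           ∎
    where open import Relation.Binary.Reasoning.Setoid setoid

  ∣ₚ-*ₛ-^ₛ : ∀ {g f} m n → g ^ₛ m ∣ₚ f → g ^ₛ (m ℕ.+ n) ∣ₚ f *ₛ g ^ₛ n
  ∣ₚ-*ₛ-^ₛ {g} m n (divides h h-poly f≈gᵐh) =
    divides h h-poly (≈ₚ-trans (*-congʳ {g ^ₛ n} f≈gᵐh) ([gᵐh]gⁿ≈gᵐ⁺ⁿh g m n h))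

  ∣ₚ-*ₛ-^ₛ⁻¹ : ∀ {g f} m n {a b} → g ^ₛ n ≐ mono a b → g ^ₛ (m ℕ.+ n) ∣ₚ f *ₛ g ^ₛ n → g ^ₛ m ∣ₚ f
  ∣ₚ-*ₛ-^ₛ⁻¹ {g} m n {a} {b} gⁿ≐mono (divides h h-poly fgⁿ≈gᵐ⁺ⁿh) =
    divides h h-poly (monomial-cancelʳ a b gⁿ≐mono (≈ₚ-trans fgⁿ≈gᵐ⁺ⁿh (≈ₚ-sym ([gᵐh]gⁿ≈gᵐ⁺ⁿh g m n h))))

  ∣ₚ-neg : ∀ {a f} → a ∣ₚ f → a ∣ₚ -ₛ f
  ∣ₚ-neg {a} (divides h h-poly f≈ah) = divides (-ₛ h) (poly-neg h-poly) (≈ₚ-trans (-‿cong f≈ah) (-‿distribʳ-* a h))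

  private
    U : Ser
    U = xₛ +ₛ yₛ

  poly-xₛ+yₛ : Poly (xₛ +ₛ yₛ)
  poly-xₛ+yₛ = poly-+ₛ (poly-resp (≐⇒≈ₚ (λ i j → sym (xₛ≐mono i j))) (poly-mono 1 0))
                      (poly-resp (≐⇒≈ₚ (λ i j → sym (yₛ≐mono i j))) (poly-mono 0 1))

  -- x + y and y are coprime: comparing the coefficients of x^(i+1) y^0 in (x + y) W and in a
  -- multiple of y shows that W has no y-free terms.
  yₛ∣U*⇒yₛ∣ : ∀ {W} → Poly W → yₛ ∣ₚ U *ₛ W → yₛ ∣ₚ W
  yₛ∣U*⇒yₛ∣ {W} W-poly (divides h _ UW≈yh) = divides W′ (poly-shift 0 1 W-poly) W≈yW′
    where
    W′ : Ser
    W′ i j = W i (suc j)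
    UW-coefficient : ∀ i → (U *ₛ W) (suc i) 0 ≡ W i 0
    UW-coefficient i = begin
      (U *ₛ W) (suc i) 0                        ≡⟨ *ₛ-distribʳ-+ₛ W xₛ yₛ (suc i) 0 ⟩
      (xₛ *ₛ W) (1 ℕ.+ i) 0 ℤ.+ (yₛ *ₛ W) (suc i) 0
        ≡⟨ cong₂ ℤ._+_ (monomial-shift 1 0 xₛ≐mono W i 0)
                       (monomial-below 0 1 yₛ≐mono W (suc i) 0 (inj₂ (s≤s z≤n))) ⟩
      W i 0 ℤ.+ + 0                             ≡⟨ ℤ.+-identityʳ (W i 0) ⟩
      W i 0                                     ∎
      where open ≡-Reasoning
    W≈yW′ : W ≈ₚ yₛ *ₛ W′
    W≈yW′ i zero    = ≡ₚ-trans (≡⇒≡ₚ (sym (UW-coefficient i))) (≡ₚ-trans (UW≈yh (suc i) 0) (≡⇒≡ₚ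
      (trans (monomial-below 0 1 yₛ≐mono h (suc i) 0 (inj₂ (s≤s z≤n)))
             (sym (monomial-below 0 1 yₛ≐mono W′ i 0 (inj₂ (s≤s z≤n)))))))
    W≈yW′ i (suc j) = ≡⇒≡ₚ (sym (monomial-shift 0 1 yₛ≐mono W′ i j))

  yₛ^∣U*⇒yₛ^∣ : ∀ n {W} → Poly W → yₛ ^ₛ n ∣ₚ U *ₛ W → yₛ ^ₛ n ∣ₚ W
  yₛ^∣U*⇒yₛ^∣ zero    {W} W-poly _ = divides W W-poly (≐⇒≈ₚ (λ i j → sym (*ₛ-identityˡ W i j)))
  yₛ^∣U*⇒yₛ^∣ (suc n) {W} W-poly (divides h h-poly UW≈yⁿ⁺¹h) =
    peel (yₛ∣U*⇒yₛ∣ W-poly (divides (yₛ ^ₛ n *ₛ h) (poly-*ₛ (poly-yₛ^ n) h-poly)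
                                    (≈ₚ-trans UW≈yⁿ⁺¹h (*-assoc yₛ (yₛ ^ₛ n) h))))
    where
    open import Relation.Binary.Reasoning.Setoid setoid
    peel : yₛ ∣ₚ W → yₛ ^ₛ suc n ∣ₚ W
    peel (divides W′ W′-poly W≈yW′) =
      restore (yₛ^∣U*⇒yₛ^∣ n W′-poly (divides h h-poly (monomial-cancel 0 1 yₛ≐mono y[UW′]≈y[yⁿh])))
      where
      y[UW′]≈y[yⁿh] : yₛ *ₛ (U *ₛ W′) ≈ₚ yₛ *ₛ (yₛ ^ₛ n *ₛ h)
      y[UW′]≈y[yⁿh] = begin
        yₛ *ₛ (U *ₛ W′)            ≈⟨ *-assoc yₛ U W′ ⟨
        (yₛ *ₛ U) *ₛ W′            ≈⟨ *-congʳ {W′} (*-comm yₛ U) ⟩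
        (U *ₛ yₛ) *ₛ W′            ≈⟨ *-assoc U yₛ W′ ⟩
        U *ₛ (yₛ *ₛ W′)            ≈⟨ *-congˡ {U} W≈yW′ ⟨
        U *ₛ W                     ≈⟨ UW≈yⁿ⁺¹h ⟩
        yₛ ^ₛ suc n *ₛ h           ≈⟨ *-assoc yₛ (yₛ ^ₛ n) h ⟩
        yₛ *ₛ (yₛ ^ₛ n *ₛ h)       ∎
      restore : yₛ ^ₛ n ∣ₚ W′ → yₛ ^ₛ suc n ∣ₚ W
      restore (divides h′ h′-poly W′≈yⁿh′) = divides h′ h′-poly (begin
        W                          ≈⟨ W≈yW′ ⟩
        yₛ *ₛ W′                   ≈⟨ *-congˡ {yₛ} W′≈yⁿh′ ⟩
        yₛ *ₛ (yₛ ^ₛ n *ₛ h′)      ≈⟨ *-assoc yₛ (yₛ ^ₛ n) h′ ⟨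
        yₛ ^ₛ suc n *ₛ h′          ∎)

  yₛ^∣U^*⇒yₛ^∣ : ∀ n m {W} → Poly W → yₛ ^ₛ n ∣ₚ U ^ₛ m *ₛ W → yₛ ^ₛ n ∣ₚ W
  yₛ^∣U^*⇒yₛ^∣ n zero    {W} _      (divides h h-poly W≈yⁿh) =
    divides h h-poly (≈ₚ-trans (≐⇒≈ₚ (λ i j → sym (*ₛ-identityˡ W i j))) W≈yⁿh)
  yₛ^∣U^*⇒yₛ^∣ n (suc m) {W} W-poly (divides h h-poly UᵐW≈yⁿh) =
    yₛ^∣U^*⇒yₛ^∣ n m W-poly (yₛ^∣U*⇒yₛ^∣ n (poly-*ₛ (poly-^ₛ m poly-xₛ+yₛ) W-poly)
      (divides h h-poly (≈ₚ-trans (≈ₚ-sym (*-assoc U (U ^ₛ m) W)) UᵐW≈yⁿh)))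

  -- The modules D(A, μ)

  infix 4 _≈ᴰ_
  record _≈ᴰ_ (θ θ′ : Der) : Set where
    constructor _,_
    field
      ≈₁ : proj₁ θ ≈ₚ proj₁ θ′
      ≈₂ : proj₂ θ ≈ₚ proj₂ θ′

  ≈ᴰ-sym : ∀ {θ θ′} → θ ≈ᴰ θ′ → θ′ ≈ᴰ θ
  ≈ᴰ-sym (e₁ , e₂) = ≈ₚ-sym e₁ , ≈ₚ-sym e₂

  ≈ᴰ-trans : ∀ {θ θ′ θ″} → θ ≈ᴰ θ′ → θ′ ≈ᴰ θ″ → θ ≈ᴰ θ″
  ≈ᴰ-trans (e₁ , e₂) (e₁′ , e₂′) = ≈ₚ-trans e₁ e₁′ , ≈ₚ-trans e₂ e₂′

  ≈ᵈ⇒≈ᴰ : ∀ {θ θ′} → θ ≈ᵈ[ p ] θ′ → θ ≈ᴰ θ′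
  ≈ᵈ⇒≈ᴰ (e₁ , e₂) = ≈[p]⇒≈ₚ e₁ , ≈[p]⇒≈ₚ e₂

  ≈ᴰ⇒≈ᵈ : ∀ {θ θ′} → θ ≈ᴰ θ′ → θ ≈ᵈ[ p ] θ′
  ≈ᴰ⇒≈ᵈ (e₁ , e₂) = ≈ₚ⇒≈[p] e₁ , ≈ₚ⇒≈[p] e₂

  combination-cong : ∀ {a a′ b b′ θ θ′ η η′} → a ≈ₚ a′ → b ≈ₚ b′ → θ ≈ᴰ η → θ′ ≈ᴰ η′ →
    (a ·ᵈ θ) +ᵈ (b ·ᵈ θ′) ≈ᴰ (a′ ·ᵈ η) +ᵈ (b′ ·ᵈ η′)
  combination-cong a≈ b≈ (e₁ , e₂) (e₁′ , e₂′) =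
    +-cong (*-cong a≈ e₁) (*-cong b≈ e₁′) , +-cong (*-cong a≈ e₂) (*-cong b≈ e₂′)

  record _∈D[_] (θ : Der) (μ : Mult) : Set where
    field
      poly₁ : Poly (proj₁ θ)
      poly₂ : Poly (proj₂ θ)
      x-divides : xₛ ^ₛ μ zero ∣ₚ proj₁ θ
      y-divides : yₛ ^ₛ μ (suc zero) ∣ₚ proj₂ θ
      x+y-divides : (xₛ +ₛ yₛ) ^ₛ μ (suc (suc zero)) ∣ₚ proj₁ θ +ₛ proj₂ θ

  InD⇒∈D : ∀ {μ θ} → InD p μ θ → θ ∈D[ μ ]
  InD⇒∈D ((f-poly , g-poly) , α-divides) = record
    { poly₁ = IsPoly⇒Poly f-poly ; poly₂ = IsPoly⇒Poly g-poly
    ; x-divides = convert (α-divides zero) ; y-divides = convert (α-divides (suc zero))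
    ; x+y-divides = convert (α-divides (suc (suc zero))) }
    where convert : ∀ {a f} → (Σ Ser λ h → IsPoly p h × f ≈[ p ] a *ₛ h) → a ∣ₚ f
          convert (h , h-poly , f≈ah) = divides h (IsPoly⇒Poly h-poly) (≈[p]⇒≈ₚ f≈ah)

  ∈D⇒InD : ∀ {μ θ} → θ ∈D[ μ ] → InD p μ θ
  ∈D⇒InD θ∈D = (Poly⇒IsPoly poly₁ , Poly⇒IsPoly poly₂) , λ
    { zero → convert x-divides ; (suc zero) → convert y-divides ; (suc (suc zero)) → convert x+y-divides }
    where open _∈D[_] θ∈D
          convert : ∀ {a f} → a ∣ₚ f → Σ Ser λ h → IsPoly p h × f ≈[ p ] a *ₛ h
          convert (divides h h-poly f≈ah) = h , Poly⇒IsPoly h-poly , ≈ₚ⇒≈[p] f≈ah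

  ∈D-resp : ∀ {μ θ θ′} → θ ≈ᴰ θ′ → θ ∈D[ μ ] → θ′ ∈D[ μ ]
  ∈D-resp (e₁ , e₂) θ∈D = record
    { poly₁ = poly-resp e₁ poly₁ ; poly₂ = poly-resp e₂ poly₂
    ; x-divides = ∣ₚ-resp e₁ x-divides ; y-divides = ∣ₚ-resp e₂ y-divides
    ; x+y-divides = ∣ₚ-resp (+-cong e₁ e₂) x+y-divides }
    where open _∈D[_] θ∈D

  module _ {μ : Mult} {θ₁ θ₂ η₁ η₂ : Der} (e₁ : θ₁ ≈ᴰ η₁) (e₂ : θ₂ ≈ᴰ η₂) where

    private
      same-combination : ∀ a b → (a ·ᵈ θ₁) +ᵈ (b ·ᵈ θ₂) ≈ᴰ (a ·ᵈ η₁) +ᵈ (b ·ᵈ η₂)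
      same-combination a b = combination-cong (≈ₚ-refl {a}) (≈ₚ-refl {b}) e₁ e₂

    IsBasis-resp : IsBasis p μ θ₁ θ₂ → IsBasis p μ η₁ η₂
    IsBasis-resp (θ₁∈D , θ₂∈D , spans , independent) =
      ∈D⇒InD (∈D-resp {μ} e₁ (InD⇒∈D θ₁∈D)) , ∈D⇒InD (∈D-resp {μ} e₂ (InD⇒∈D θ₂∈D)) , spans′ , independent′
      where
      spans′ : ∀ ζ → InD p μ ζ →
        Σ Ser λ a → Σ Ser λ b → IsPoly p a × IsPoly p b × ζ ≈ᵈ[ p ] (a ·ᵈ η₁) +ᵈ (b ·ᵈ η₂)
      spans′ ζ ζ∈D with spans ζ ζ∈D
      ... | a , b , a-poly , b-poly , ζ≈ =
        a , b , a-poly , b-poly , ≈ᴰ⇒≈ᵈ (≈ᴰ-trans (≈ᵈ⇒≈ᴰ {ζ} ζ≈) (same-combination a b))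
      independent′ : ∀ a b → IsPoly p a → IsPoly p b →
        (a ·ᵈ η₁) +ᵈ (b ·ᵈ η₂) ≈ᵈ[ p ] zeroᵈ → a ≈[ p ] zeroₛ × b ≈[ p ] zeroₛ
      independent′ a b a-poly b-poly ≈0 =
        independent a b a-poly b-poly (≈ᴰ⇒≈ᵈ (≈ᴰ-trans (same-combination a b) (≈ᵈ⇒≈ᴰ {θ′ = zeroᵈ} ≈0)))

  zero-combination : ∀ θ θ′ → (zeroₛ ·ᵈ θ) +ᵈ (zeroₛ ·ᵈ θ′) ≈ᴰ zeroᵈ
  zero-combination θ θ′ = vanish (proj₁ θ) (proj₁ θ′) , vanish (proj₂ θ) (proj₂ θ′)
    where vanish : ∀ f f′ → (zeroₛ *ₛ f) +ₛ (zeroₛ *ₛ f′) ≈ₚ zeroₛ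
          vanish f f′ = ≈ₚ-trans (+-cong (zeroˡ f) (zeroˡ f′)) (+-identityʳ zeroₛ)

  IsBasis⇒nonzero : p ≢ 1 → ∀ {μ θ θ′} → IsBasis p μ θ θ′ → ¬ θ ≈ᴰ zeroᵈ × ¬ θ′ ≈ᴰ zeroᵈ
  IsBasis⇒nonzero p≢1 {θ = f , g} {f′ , g′} (_ , _ , _ , independent) =
    (λ (f≈0 , g≈0) → one≢zero (proj₁ (independent oneₛ zeroₛ one-poly zero-poly
      (≈ₚ⇒≈[p] (vanish (unit f≈0) (zeroˡ f′)) , ≈ₚ⇒≈[p] (vanish (unit g≈0) (zeroˡ g′)))))) ,
    (λ (f′≈0 , g′≈0) → one≢zero (proj₂ (independent zeroₛ oneₛ zero-poly one-poly
      (≈ₚ⇒≈[p] (vanish (zeroˡ f) (unit f′≈0)) , ≈ₚ⇒≈[p] (vanish (zeroˡ g) (unit g′≈0))))))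
    where
    one-poly : IsPoly p oneₛ
    one-poly = Poly⇒IsPoly (poly-xₛ^ 0)
    zero-poly : IsPoly p zeroₛ
    zero-poly = 0 , λ _ _ _ → ≡ₚ⇒≡[p] (≡ₚ-refl {+ 0})
    one≢zero : ¬ oneₛ ≈[ p ] zeroₛ
    one≢zero 1≈0 = p≢1 (1≡ₚ0⇒p≡1 (mk≡ₚ (1≈0 0 0)))
    unit : ∀ {h} → h ≈ₚ zeroₛ → oneₛ *ₛ h ≈ₚ zeroₛ
    unit {h} h≈0 = ≈ₚ-trans (*-identityˡ h) h≈0
    vanish : ∀ {u v} → u ≈ₚ zeroₛ → v ≈ₚ zeroₛ → u +ₛ v ≈ₚ zeroₛ
    vanish u≈0 v≈0 = ≈ₚ-trans (+-cong u≈0 v≈0) (+-identityʳ zeroₛ)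

  Homogeneous : ℕ → Der → Set
  Homogeneous k θ = ∀ i j → i ℕ.+ j ≢ k → proj₁ θ i j ≡ₚ + 0 × proj₂ θ i j ≡ₚ + 0

  IsHomog⇒Homogeneous : ∀ {k θ} → IsHomog p k θ → Homogeneous k θ
  IsHomog⇒Homogeneous hom i j ne = mk≡ₚ (proj₁ (hom i j ne)) , mk≡ₚ (proj₂ (hom i j ne))

  Homogeneous⇒IsHomog : ∀ {k θ} → Homogeneous k θ → IsHomog p k θ
  Homogeneous⇒IsHomog hom i j ne = ≡ₚ⇒≡[p] (proj₁ (hom i j ne)) , ≡ₚ⇒≡[p] (proj₂ (hom i j ne))

  record IsDIsomorphism (μ ν : Mult) (Φ : Der → Der) : Set where
    field
      Φ-cong      : ∀ {θ θ′} → θ ≈ᴰ θ′ → Φ θ ≈ᴰ Φ θ′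
      Φ-injective : ∀ {θ θ′} → Φ θ ≈ᴰ Φ θ′ → θ ≈ᴰ θ′
      Φ-linear    : ∀ a b θ θ′ → Φ ((a ·ᵈ θ) +ᵈ (b ·ᵈ θ′)) ≈ᴰ (a ·ᵈ Φ θ) +ᵈ (b ·ᵈ Φ θ′)
      Φ-into      : ∀ {θ} → θ ∈D[ μ ] → Φ θ ∈D[ ν ]
      Φ-onto      : ∀ {η} → η ∈D[ ν ] → Σ Der λ θ → θ ∈D[ μ ] × Φ θ ≈ᴰ η

    Φ-zero : Φ zeroᵈ ≈ᴰ zeroᵈ
    Φ-zero = ≈ᴰ-trans (Φ-cong (≈ᴰ-sym (zero-combination zeroᵈ zeroᵈ)))
               (≈ᴰ-trans (Φ-linear zeroₛ zeroₛ zeroᵈ zeroᵈ) (zero-combination (Φ zeroᵈ) (Φ zeroᵈ)))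

  module _ {μ ν : Mult} {Φ : Der → Der} (iso : IsDIsomorphism μ ν Φ) {θ θ′ : Der} where
    open IsDIsomorphism iso

    private
      Φ-combination : ∀ a b → Φ ((a ·ᵈ θ) +ᵈ (b ·ᵈ θ′)) ≈ᴰ (a ·ᵈ Φ θ) +ᵈ (b ·ᵈ Φ θ′)
      Φ-combination a b = Φ-linear a b θ θ′

    IsBasis-image : IsBasis p μ θ θ′ → IsBasis p ν (Φ θ) (Φ θ′)
    IsBasis-image (θ∈D , θ′∈D , spans , independent) =
      ∈D⇒InD (Φ-into (InD⇒∈D θ∈D)) , ∈D⇒InD (Φ-into (InD⇒∈D θ′∈D)) , spans′ , independent′
      where
      spans′ : ∀ η → InD p ν η →
        Σ Ser λ a → Σ Ser λ b → IsPoly p a × IsPoly p b × η ≈ᵈ[ p ] (a ·ᵈ Φ θ) +ᵈ (b ·ᵈ Φ θ′)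
      spans′ η η∈D with Φ-onto (InD⇒∈D η∈D)
      ... | ζ , ζ∈D , Φζ≈η with spans ζ (∈D⇒InD ζ∈D)
      ... | a , b , a-poly , b-poly , ζ≈ = a , b , a-poly , b-poly ,
        ≈ᴰ⇒≈ᵈ (≈ᴰ-trans (≈ᴰ-sym Φζ≈η) (≈ᴰ-trans (Φ-cong (≈ᵈ⇒≈ᴰ {ζ} ζ≈)) (Φ-combination a b)))
      independent′ : ∀ a b → IsPoly p a → IsPoly p b →
        (a ·ᵈ Φ θ) +ᵈ (b ·ᵈ Φ θ′) ≈ᵈ[ p ] zeroᵈ → a ≈[ p ] zeroₛ × b ≈[ p ] zeroₛ
      independent′ a b a-poly b-poly ≈0 = independent a b a-poly b-poly (≈ᴰ⇒≈ᵈ (Φ-injective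
        (≈ᴰ-trans (Φ-combination a b) (≈ᴰ-trans (≈ᵈ⇒≈ᴰ {θ′ = zeroᵈ} ≈0) (≈ᴰ-sym Φ-zero)))))

    IsBasis-preimage : IsBasis p ν (Φ θ) (Φ θ′) → IsBasis p μ θ θ′
    IsBasis-preimage (Φθ∈D , Φθ′∈D , spans , independent) =
      ∈D⇒InD (reflect (InD⇒∈D Φθ∈D)) , ∈D⇒InD (reflect (InD⇒∈D Φθ′∈D)) , spans′ , independent′
      where
      reflect : ∀ {ζ} → Φ ζ ∈D[ ν ] → ζ ∈D[ μ ]
      reflect Φζ∈D with Φ-onto Φζ∈D
      ... | ζ′ , ζ′∈D , Φζ′≈Φζ = ∈D-resp (Φ-injective Φζ′≈Φζ) ζ′∈D
      spans′ : ∀ η → InD p μ η →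
        Σ Ser λ a → Σ Ser λ b → IsPoly p a × IsPoly p b × η ≈ᵈ[ p ] (a ·ᵈ θ) +ᵈ (b ·ᵈ θ′)
      spans′ η η∈D with spans (Φ η) (∈D⇒InD (Φ-into (InD⇒∈D η∈D)))
      ... | a , b , a-poly , b-poly , Φη≈ = a , b , a-poly , b-poly ,
        ≈ᴰ⇒≈ᵈ (Φ-injective (≈ᴰ-trans (≈ᵈ⇒≈ᴰ {Φ η} Φη≈) (≈ᴰ-sym (Φ-combination a b))))
      independent′ : ∀ a b → IsPoly p a → IsPoly p b →
        (a ·ᵈ θ) +ᵈ (b ·ᵈ θ′) ≈ᵈ[ p ] zeroᵈ → a ≈[ p ] zeroₛ × b ≈[ p ] zeroₛ
      independent′ a b a-poly b-poly ≈0 = independent a b a-poly b-poly (≈ᴰ⇒≈ᵈ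
        (≈ᴰ-trans (≈ᴰ-sym (Φ-combination a b)) (≈ᴰ-trans (Φ-cong (≈ᵈ⇒≈ᴰ {θ′ = zeroᵈ} ≈0)) Φ-zero)))

  -- The map Ψ_d

  module Shift (d : ℕ) where

    q : ℕ
    q = p ℕ.^ d

    private
      X Y : Ser
      X = xₛ ^ₛ q
      Y = yₛ ^ₛ q

    Ψ-cong : ∀ {θ θ′} → θ ≈ᴰ θ′ → Ψ p d θ ≈ᴰ Ψ p d θ′
    Ψ-cong (e₁ , e₂) = *-congʳ {X} e₁ , -‿cong (*-congʳ {Y} e₂)

    Ψ-injective : ∀ {θ θ′} → Ψ p d θ ≈ᴰ Ψ p d θ′ → θ ≈ᴰ θ′
    Ψ-injective {f , g} {f′ , g′} (e₁ , e₂) =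
      monomial-cancelʳ q 0 (xₛ^≐mono q) e₁ ,
      monomial-cancelʳ 0 q (yₛ^≐mono q) (-‿injective {g *ₛ Y} {g′ *ₛ Y} e₂)

    Ψ-linear : ∀ a b θ θ′ → Ψ p d ((a ·ᵈ θ) +ᵈ (b ·ᵈ θ′)) ≈ᴰ (a ·ᵈ Ψ p d θ) +ᵈ (b ·ᵈ Ψ p d θ′)
    Ψ-linear a b (f , g) (f′ , g′) = scale-distrib X f f′ , (begin
      -ₛ (((a *ₛ g) +ₛ (b *ₛ g′)) *ₛ Y)           ≈⟨ -‿cong (scale-distrib Y g g′) ⟩
      -ₛ ((a *ₛ (g *ₛ Y)) +ₛ (b *ₛ (g′ *ₛ Y)))     ≈⟨ -‿+-comm (a *ₛ (g *ₛ Y)) (b *ₛ (g′ *ₛ Y)) ⟨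
      -ₛ (a *ₛ (g *ₛ Y)) +ₛ -ₛ (b *ₛ (g′ *ₛ Y))   ≈⟨ +-cong (-‿distribʳ-* a (g *ₛ Y)) (-‿distribʳ-* b (g′ *ₛ Y)) ⟩
      (a *ₛ -ₛ (g *ₛ Y)) +ₛ (b *ₛ -ₛ (g′ *ₛ Y))   ∎)
      where
      open import Relation.Binary.Reasoning.Setoid setoid
      scale-distrib : ∀ Z h h′ → ((a *ₛ h) +ₛ (b *ₛ h′)) *ₛ Z ≈ₚ (a *ₛ (h *ₛ Z)) +ₛ (b *ₛ (h′ *ₛ Z))
      scale-distrib Z h h′ = ≈ₚ-trans (distribʳ Z (a *ₛ h) (b *ₛ h′)) (+-cong (*-assoc a h Z) (*-assoc b h′ Z))

    Ψ⁻¹ : Der → Der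
    Ψ⁻¹ η = (λ i j → proj₁ η (q ℕ.+ i) j) , -ₛ (λ i j → proj₂ η i (q ℕ.+ j))

    Ψ∘Ψ⁻¹ : ∀ {η} → (∀ i j → i < q → proj₁ η i j ≡ₚ + 0) → (∀ i j → j < q → proj₂ η i j ≡ₚ + 0) →
      Ψ p d (Ψ⁻¹ η) ≈ᴰ η
    Ψ∘Ψ⁻¹ {f , g} f-low g-low =
      first , ≈ₚ-trans (-‿cong (≈ₚ-sym (-‿distribˡ-* G Y))) (≈ₚ-trans (-‿involutive (G *ₛ Y)) second)
      where
      F G : Ser
      F i j = f (q ℕ.+ i) j
      G i j = g i (q ℕ.+ j)
      first : F *ₛ X ≈ₚ f
      first i j with shiftView q i
      ... | above k    = ≡⇒≡ₚ (monomial-shiftʳ q 0 (xₛ^≐mono q) F k j)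
      ... | below i<q  =
        ≡ₚ-trans (≡⇒≡ₚ (monomial-belowʳ q 0 (xₛ^≐mono q) F i j (inj₁ i<q))) (≡ₚ-sym (f-low i j i<q))
      second : G *ₛ Y ≈ₚ g
      second i j with shiftView q j
      ... | above k    = ≡⇒≡ₚ (monomial-shiftʳ 0 q (yₛ^≐mono q) G i k)
      ... | below j<q  =
        ≡ₚ-trans (≡⇒≡ₚ (monomial-belowʳ 0 q (yₛ^≐mono q) G i j (inj₂ j<q))) (≡ₚ-sym (g-low i j j<q))

    Ψ∘Ψ⁻¹-on-D : ∀ {μ η} → η ∈D[ shift p d μ ] → Ψ p d (Ψ⁻¹ η) ≈ᴰ η
    Ψ∘Ψ⁻¹-on-D {μ} η∈D = Ψ∘Ψ⁻¹
      (λ i j i<q → monomial∣-below (μ zero ℕ.+ q) 0 (xₛ^≐mono _) x-divides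
                     (inj₁ (ℕ.<-≤-trans i<q (ℕ.m≤n+m q (μ zero)))))
      (λ i j j<q → monomial∣-below 0 (μ (suc zero) ℕ.+ q) (yₛ^≐mono _) y-divides
                     (inj₂ (ℕ.<-≤-trans j<q (ℕ.m≤n+m q (μ (suc zero))))))
      where open _∈D[_] η∈D

    Ψ-homogeneous : ∀ {k θ} → Homogeneous k θ → Homogeneous (q ℕ.+ k) (Ψ p d θ)
    Ψ-homogeneous {k} {f , g} hom i j i+j≢q+k =
      first (shiftView q i) i+j≢q+k , second (shiftView q j) i+j≢q+k
      where
      first : ∀ {i} → ShiftView q i → i ℕ.+ j ≢ q ℕ.+ k → (f *ₛ X) i j ≡ₚ + 0
      first (above i′) ne = ≡ₚ-trans (≡⇒≡ₚ (monomial-shiftʳ q 0 (xₛ^≐mono q) f i′ j))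
        (proj₁ (hom i′ j λ e → ne (trans (ℕ.+-assoc q i′ j) (cong (q ℕ.+_) e))))
      first {i} (below i<q) _ = ≡⇒≡ₚ (monomial-belowʳ q 0 (xₛ^≐mono q) f i j (inj₁ i<q))
      second : ∀ {j} → ShiftView q j → i ℕ.+ j ≢ q ℕ.+ k → (-ₛ (g *ₛ Y)) i j ≡ₚ + 0
      second (above j′) ne = -‿cong-≡ₚ (≡ₚ-trans (≡⇒≡ₚ (monomial-shiftʳ 0 q (yₛ^≐mono q) g i j′))
        (proj₂ (hom i j′ λ e → ne (trans (ℕ+.x∙yz≈y∙xz i q j′) (cong (q ℕ.+_) e)))))
      second {j} (below j<q) _ = -‿cong-≡ₚ (≡⇒≡ₚ (monomial-belowʳ 0 q (yₛ^≐mono q) g i j (inj₂ j<q)))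

    Ψ⁻¹-homogeneous : ∀ {k η} → Homogeneous k η → Homogeneous (k ∸ q) (Ψ⁻¹ η)
    Ψ⁻¹-homogeneous {k} {f , g} hom i j i+j≢k∸q =
      proj₁ (hom (q ℕ.+ i) j λ e → i+j≢k∸q (unshift (trans (sym (ℕ.+-assoc q i j)) e))) ,
      -‿cong-≡ₚ (proj₂ (hom i (q ℕ.+ j) λ e → i+j≢k∸q (unshift (trans (sym (ℕ+.x∙yz≈y∙xz i q j)) e))))
      where
      unshift : ∀ {n} → q ℕ.+ n ≡ k → n ≡ k ∸ q
      unshift {n} e = trans (sym (ℕ.m+n∸m≡n q n)) (cong (_∸ q) e)

    low-degree-vanishes : ∀ {μ k η} → η ∈D[ shift p d μ ] → Homogeneous k η → k < q → η ≈ᴰ zeroᵈ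
    low-degree-vanishes {μ} {k} {η} η∈D hom k<q = vanish₁ , vanish₂
      where
      open _∈D[_] η∈D
      vanish₁ : proj₁ η ≈ₚ zeroₛ
      vanish₁ i j with i ℕ.+ j ℕ.≟ k
      ... | no  i+j≢k = proj₁ (hom i j i+j≢k)
      ... | yes refl  = monomial∣-below (μ zero ℕ.+ q) 0 (xₛ^≐mono _) x-divides
                          (inj₁ (ℕ.≤-<-trans (ℕ.m≤m+n i j) (ℕ.<-≤-trans k<q (ℕ.m≤n+m q (μ zero)))))
      vanish₂ : proj₂ η ≈ₚ zeroₛ
      vanish₂ i j with i ℕ.+ j ℕ.≟ k
      ... | no  i+j≢k = proj₂ (hom i j i+j≢k)
      ... | yes refl  = monomial∣-below 0 (μ (suc zero) ℕ.+ q) (yₛ^≐mono _) y-divides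
                          (inj₂ (ℕ.≤-<-trans (ℕ.m≤n+m j i) (ℕ.<-≤-trans k<q (ℕ.m≤n+m q (μ (suc zero))))))

    nonzero-degree≥q : ∀ {μ k η} → η ∈D[ shift p d μ ] → Homogeneous k η → ¬ η ≈ᴰ zeroᵈ → q ≤ k
    nonzero-degree≥q {k = k} η∈D hom η≢0 with q ℕ.≤? k
    ... | yes q≤k = q≤k
    ... | no  q≰k = contradiction (low-degree-vanishes η∈D hom (ℕ.≰⇒> q≰k)) η≢0


    module _ (p-prime : Prime p) {μ : Mult} (μ₂≤q : μ (suc (suc zero)) ≤ q) where

      private
        m : ℕ
        m = μ (suc (suc zero))

        frobenius-split : U ^ₛ m *ₛ U ^ₛ (q ∸ m) ≈ₚ X +ₛ Y
        frobenius-split = ≈ₚ-trans (≈ₚ-sym (^ₛ-homo-*ₛ U m (q ∸ m)))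
          (subst (λ n → U ^ₛ n ≈ₚ X +ₛ Y) (sym (ℕ.m+[n∸m]≡n μ₂≤q)) (frobeniusₛ p-prime d))

      Ψ-into : ∀ {θ} → θ ∈D[ μ ] → Ψ p d θ ∈D[ shift p d μ ]
      Ψ-into {f , g} θ∈D = record
        { poly₁ = poly-*ₛ poly₁ (poly-xₛ^ q)
        ; poly₂ = poly-neg (poly-*ₛ poly₂ (poly-yₛ^ q))
        ; x-divides = ∣ₚ-*ₛ-^ₛ (μ zero) q x-divides
        ; y-divides = ∣ₚ-neg (∣ₚ-*ₛ-^ₛ (μ (suc zero)) q y-divides)
        ; x+y-divides = twisted x+y-divides }
        where
        open _∈D[_] θ∈D
        twisted : U ^ₛ m ∣ₚ f +ₛ g → U ^ₛ m ∣ₚ (f *ₛ X) +ₛ -ₛ (g *ₛ Y)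
        twisted (divides h h-poly f+g≈Uᵐh) =
          divides (f *ₛ U ^ₛ (q ∸ m) +ₛ -ₛ (h *ₛ Y))
                  (poly-+ₛ (poly-*ₛ poly₁ (poly-^ₛ (q ∸ m) poly-xₛ+yₛ)) (poly-neg (poly-*ₛ h-poly (poly-yₛ^ q))))
                  (≈ₚ-sym (twist 𝔽ₚ⟦x,y⟧ (U ^ₛ m) (U ^ₛ (q ∸ m)) X Y f frobenius-split g h (≈ₚ-sym f+g≈Uᵐh)))

      Ψ-reflects : ∀ {θ} → Ψ p d θ ∈D[ shift p d μ ] → θ ∈D[ μ ]
      Ψ-reflects {f , g} Ψθ∈D = record
        { poly₁ = f-poly
        ; poly₂ = g-poly
        ; x-divides = ∣ₚ-*ₛ-^ₛ⁻¹ (μ zero) q (xₛ^≐mono q) x-divides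
        ; y-divides = ∣ₚ-*ₛ-^ₛ⁻¹ (μ (suc zero)) q (yₛ^≐mono q)
                        (∣ₚ-resp (-‿involutive (g *ₛ Y)) (∣ₚ-neg y-divides))
        ; x+y-divides = untwisted x+y-divides }
        where
        open _∈D[_] Ψθ∈D
        open import Relation.Binary.Reasoning.Setoid setoid
        f-poly : Poly f
        f-poly = poly-resp (λ i j → ≡⇒≡ₚ (monomial-shiftʳ q 0 (xₛ^≐mono q) f i j)) (poly-shift q 0 poly₁)
        g-poly : Poly g
        g-poly = poly-resp (λ i j → ≡⇒≡ₚ (monomial-shiftʳ 0 q (yₛ^≐mono q) g i j))
                           (poly-shift 0 q (poly-resp (-‿involutive (g *ₛ Y)) (poly-neg poly₂)))
        untwisted : U ^ₛ m ∣ₚ (f *ₛ X) +ₛ -ₛ (g *ₛ Y) → U ^ₛ m ∣ₚ f +ₛ g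
        untwisted (divides k k-poly Ψθ≈Uᵐk) =
          cancel-Y (yₛ^∣U^*⇒yₛ^∣ q m K-poly (divides (f +ₛ g) (poly-+ₛ f-poly g-poly) UᵐK≈Y[f+g]))
          where
          K : Ser
          K = f *ₛ U ^ₛ (q ∸ m) +ₛ -ₛ k
          K-poly : Poly K
          K-poly = poly-+ₛ (poly-*ₛ f-poly (poly-^ₛ (q ∸ m) poly-xₛ+yₛ)) (poly-neg k-poly)
          UᵐK≈Y[f+g] : U ^ₛ m *ₛ K ≈ₚ Y *ₛ (f +ₛ g)
          UᵐK≈Y[f+g] = ≈ₚ-trans
            (untwist 𝔽ₚ⟦x,y⟧ (U ^ₛ m) (U ^ₛ (q ∸ m)) X Y f frobenius-split g k (≈ₚ-sym Ψθ≈Uᵐk))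
            (*-comm (f +ₛ g) Y)
          cancel-Y : Y ∣ₚ K → U ^ₛ m ∣ₚ f +ₛ g
          cancel-Y (divides K′ K′-poly K≈YK′) =
            divides K′ K′-poly (monomial-cancel 0 q (yₛ^≐mono q) (begin
            Y *ₛ (f +ₛ g)              ≈⟨ UᵐK≈Y[f+g] ⟨
            U ^ₛ m *ₛ K                ≈⟨ *-congˡ {U ^ₛ m} K≈YK′ ⟩
            U ^ₛ m *ₛ (Y *ₛ K′)        ≈⟨ x∙yz≈y∙xz (U ^ₛ m) Y K′ ⟩
            Y *ₛ (U ^ₛ m *ₛ K′)        ∎))

      Ψ-onto : ∀ {η} → η ∈D[ shift p d μ ] → Σ Der λ θ → θ ∈D[ μ ] × Ψ p d θ ≈ᴰ η
      Ψ-onto {η} η∈D = Ψ⁻¹ η , Ψ-reflects (∈D-resp (≈ᴰ-sym (Ψ∘Ψ⁻¹-on-D η∈D)) η∈D) , Ψ∘Ψ⁻¹-on-D η∈D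

      Ψ-isDIsomorphism : IsDIsomorphism μ (shift p d μ) (Ψ p d)
      Ψ-isDIsomorphism = record
        { Φ-cong = Ψ-cong ; Φ-injective = Ψ-injective ; Φ-linear = Ψ-linear ; Φ-into = Ψ-into ; Φ-onto = Ψ-onto }

      HasΔ-image : ∀ {n} → HasΔ p μ n → HasΔ p (shift p d μ) n
      HasΔ-image (k , k′ , (θ , θ′ , basis , hom , hom′) , n≡∣k-k′∣) =
        q ℕ.+ k , q ℕ.+ k′ ,
        (Ψ p d θ , Ψ p d θ′ , IsBasis-image Ψ-isDIsomorphism basis , raise {k} {θ} hom , raise {k′} {θ′} hom′) ,
        trans n≡∣k-k′∣ (sym (ℕ.∣m+n-m+o∣≡∣n-o∣ q k k′))
        where
        raise : ∀ {k θ} → IsHomog p k θ → IsHomog p (q ℕ.+ k) (Ψ p d θ)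
        raise {k} {θ} =
          Homogeneous⇒IsHomog {q ℕ.+ k} {Ψ p d θ} ∘ Ψ-homogeneous {k} {θ} ∘ IsHomog⇒Homogeneous {k} {θ}

      HasΔ-preimage : ∀ {n} → HasΔ p (shift p d μ) n → HasΔ p μ n
      HasΔ-preimage (k , k′ , (η , η′ , basis , hom , hom′) , n≡∣k-k′∣) =
        k ∸ q , k′ ∸ q ,
        (Ψ⁻¹ η , Ψ⁻¹ η′ , IsBasis-preimage Ψ-isDIsomorphism basis′ , lower {k} {η} hom , lower {k′} {η′} hom′) ,
        trans n≡∣k-k′∣ same-difference
        where
        η∈D : η ∈D[ shift p d μ ]
        η∈D = InD⇒∈D (proj₁ basis)
        η′∈D : η′ ∈D[ shift p d μ ]
        η′∈D = InD⇒∈D (proj₁ (proj₂ basis))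
        basis′ : IsBasis p (shift p d μ) (Ψ p d (Ψ⁻¹ η)) (Ψ p d (Ψ⁻¹ η′))
        basis′ = IsBasis-resp {shift p d μ} (≈ᴰ-sym (Ψ∘Ψ⁻¹-on-D η∈D)) (≈ᴰ-sym (Ψ∘Ψ⁻¹-on-D η′∈D)) basis
        lower : ∀ {k η} → IsHomog p k η → IsHomog p (k ∸ q) (Ψ⁻¹ η)
        lower {k} {η} =
          Homogeneous⇒IsHomog {k ∸ q} {Ψ⁻¹ η} ∘ Ψ⁻¹-homogeneous {k} {η} ∘ IsHomog⇒Homogeneous {k} {η}
        nonzero : ¬ η ≈ᴰ zeroᵈ × ¬ η′ ≈ᴰ zeroᵈ
        nonzero = IsBasis⇒nonzero (λ p≡1 → ¬prime[1] (subst Prime p≡1 p-prime)) {shift p d μ} basis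
        q≤k : q ≤ k
        q≤k = nonzero-degree≥q η∈D (IsHomog⇒Homogeneous {k} {η} hom) (proj₁ nonzero)
        q≤k′ : q ≤ k′
        q≤k′ = nonzero-degree≥q η′∈D (IsHomog⇒Homogeneous {k′} {η′} hom′) (proj₂ nonzero)
        same-difference : ℕ.∣ k - k′ ∣ ≡ ℕ.∣ k ∸ q - k′ ∸ q ∣
        same-difference = trans (cong₂ ℕ.∣_-_∣ (sym (ℕ.m+[n∸m]≡n q≤k)) (sym (ℕ.m+[n∸m]≡n q≤k′)))
                                (ℕ.∣m+n-m+o∣≡∣n-o∣ q (k ∸ q) (k′ ∸ q))

theorem4p2 : (p : ℕ) → Prime p → (μ : Mult) → (d : ℕ) → 0 < d →
    μ (suc (suc zero)) ≤ p ℕ.^ d →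
    ((θ θ' : Der) → IsDer p θ → IsDer p θ' →
      (IsBasis p μ θ θ' ⇔ IsBasis p (shift p d μ) (Ψ p d θ) (Ψ p d θ'))) ×
    ((n : ℕ) → (HasΔ p μ n ⇔ HasΔ p (shift p d μ) n))
theorem4p2 p p-prime μ d _ μ₂≤pᵈ =
  (λ θ θ′ _ _ → mk⇔ (IsBasis-image iso) (IsBasis-preimage iso)) ,
  (λ n → mk⇔ (HasΔ-image p-prime μ₂≤pᵈ) (HasΔ-preimage p-prime μ₂≤pᵈ))
  where
  open Modulo p
  open Shift d
  iso : IsDIsomorphism μ (shift p d μ) (Ψ p d)
  iso = Ψ-isDIsomorphism p-prime μ₂≤pᵈ
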